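{- Let $k\ge1$, let $t_1,\dots,t_k$ be integers, let $p$ be a prime with $p\nmid t_k$, and suppose the reduction $\bar{\mathcal{C}}\in\mathbb{F}_p[X]$ of $\mathcal{C}(X)=X^k-t_1X^{k-1}-\dots-t_k$ is reducible over $\mathbb{F}_p$. Let $g_1,\dots,g_s$ be the distinct monic irreducible factors of $\bar{\mathcal{C}}$ in $\mathbb{F}_p[X]$, and let $L=\operatorname{lcm}(\pi(g_1),\dots,\pi(g_s))$. If $p\nmid c_p[t_1,\dots,t_k]$, then $c_p[t_1,\dots,t_k]=L$. If $p\mid c_p[t_1,\dots,t_k]$, then $c_p[t_1,\dots,t_k]$ is a multiple of $L$ and $c_p[t_1,\dots,t_k]\neq L$.
   Context: $c_p[t_1,\dots,t_k]$ is the least period of the sequence $(F_{k,n}(t_1,\dots,t_k)\bmod p)_{n\ge0}$, where $F_{k,n}$ is defined by $F_{k,0}=1$, $F_{k,m}=0$ for $-k+1\le m\le -1$, and $F_{k,n}=\sum_{j=1}^kt_jF_{k,n-j}$ for $n\ge1$ (equivalently $F_{k,n}=\sum_{\alpha}\binom{|\alpha|}{\alpha_1,\dots,\alpha_k}t^\alpha$ over $\alpha\in\mathbb{Z}_{\ge0}^k$ with $\sum_jj\alpha_j=n$). For a monic polynomial $g=X^d-s_1X^{d-1}-\dots-s_d\in\mathbb{F}_p[X]$ with $s_d\neq0$, its $p$-period $\pi(g)$ is the least period of the sequence $(h_n)_{n\ge0}$ in $\mathbb{F}_p$ with $h_0=1$, $h_m=0$ for $-d+1\le m\le -1$, and $h_n=\sum_{j=1}^ds_jh_{n-j}$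 for $n\ge1$. -}

module Defs where

open import Data.Nat as ℕ using (ℕ; zero; suc; _∸_)
open import Data.Nat.LCM using (lcm)
open import Data.Integer as ℤ using (ℤ; +_; _-_; -_)
open import Data.Integer.Divisibility using () renaming (_∣_ to _∣ℤ_)
open import Data.List using (List; []; _∷_; _++_; [_]; map; reverse; replicate; zipWith; foldr; length)
open import Data.Product using (Σ; _×_)
open import Relation.Nullary using (¬_)

_≡_[mod_] : ℤ → ℤ → ℕ → Set
a ≡ b [mod p ] = (+ p) ∣ℤ (a - b)

-- For s = (s_1, …, s_d), `lrs s` is the sequence (h_n) with h_0 = 1,
-- h_m = 0 for -d+1 ≤ m ≤ -1, h_n = Σ_j s_j h_{n-j}.
-- The state (window) at time n is (h_n, h_{n-1}, …, h_{n-d+1}).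

dropLast : List ℤ → List ℤ
dropLast []           = []
dropLast (x ∷ [])     = []
dropLast (x ∷ y ∷ ys) = x ∷ dropLast (y ∷ ys)

dot : List ℤ → List ℤ → ℤ
dot s w = foldr ℤ._+_ (+ 0) (zipWith ℤ._*_ s w)

window : List ℤ → ℕ → List ℤ
window s zero    = + 1 ∷ replicate (length s ∸ 1) (+ 0)
window s (suc n) = dot s (window s n) ∷ dropLast (window s n)

headOr0 : List ℤ → ℤ
headOr0 []      = + 0
headOr0 (x ∷ _) = x

lrs : List ℤ → ℕ → ℤ
lrs s n = headOr0 (window s n)

F : List ℤ → ℕ → ℤ
F ts = lrs ts

IsPeriod : ℕ → (ℕ → ℤ) → ℕ → Set
IsPeriod p x c = ∀ n → x (n ℕ.+ c) ≡ x n [mod p ]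

IsLeastPeriod : ℕ → (ℕ → ℤ) → ℕ → Set
IsLeastPeriod p x c =
  1 ℕ.≤ c × IsPeriod p x c × (∀ c′ → 1 ℕ.≤ c′ → IsPeriod p x c′ → c ℕ.≤ c′)

-- Polynomials over F_p, as little-endian integer coefficient lists,
-- compared coefficientwise modulo p.

coeff : List ℤ → ℕ → ℤ
coeff []      _       = + 0
coeff (a ∷ f) zero    = a
coeff (a ∷ f) (suc i) = coeff f i

PolyEq : ℕ → List ℤ → List ℤ → Set
PolyEq p f g = ∀ i → coeff f i ≡ coeff g i [mod p ]

_+ₚ_ : List ℤ → List ℤ → List ℤ
[]      +ₚ g       = g
(a ∷ f) +ₚ []      = a ∷ f
(a ∷ f) +ₚ (b ∷ g) = (a ℤ.+ b) ∷ (f +ₚ g)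

_*ₚ_ : List ℤ → List ℤ → List ℤ
[]      *ₚ g = []
(a ∷ f) *ₚ g = map (a ℤ.*_) g +ₚ (+ 0 ∷ (f *ₚ g))

-- The monic polynomial X^d - s_1 X^{d-1} - … - s_d, for s = (s_1,…,s_d)
monicPoly : List ℤ → List ℤ
monicPoly s = reverse (map -_ s) ++ [ + 1 ]

-- monic g = X^d - s_1X^{d-1} - … - s_d is irreducible in F_p[X]:
-- positive degree and not a product of two monic polynomials of
-- positive degree (for monic g this is the usual notion, since units
-- of F_p[X] are the nonzero constants).
MonicIrreducible : ℕ → List ℤ → Set
MonicIrreducible p s =
  1 ℕ.≤ length s ×
  (∀ a b → 1 ℕ.≤ length a → 1 ℕ.≤ length b →
     ¬ PolyEq p (monicPoly a *ₚ monicPoly b) (monicPoly s))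

MonicDivides : ℕ → List ℤ → List ℤ → Set
MonicDivides p g f = Σ (List ℤ) λ q → PolyEq p (monicPoly g *ₚ q) (monicPoly f)

lcmList : List ℕ → ℕ
lcmList = foldr lcm 1

{-# OPTIONS --safe #-}

-- Polynomials act on integer sequences through the shift,
-- (X·x) n = x (n + 1), and the recurrence sequence of a monic g, preceded by its zero initial
-- values, is annihilated modulo p exactly by the multiples of g. Hence, when g(0) ≢ 0, c is a
-- period of the sequence of g iff g ∣ X^c − 1 in 𝔽ₚ[X]. Every gᵢ divides 𝒞, so every π(gᵢ),
-- and hence L, divides c.
--
-- The least period π of an irreducible g is prime to p: if π = qp then X^π − 1 = (X^q − 1)^p
-- by Frobenius, so g ∣ X^q − 1 and the smaller q would be a period. Thus p ∤ L, and c ≠ L when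
-- p ∣ c. When p ∤ c, write c = qL, so that X^c − 1 = (X^L − 1)·Φ with Φ = Σ_{j<q} X^{jL}.
-- Every irreducible factor of 𝒞 divides X^L − 1, since its least period divides L, and none
-- divides Φ, since Φ acts on an L-periodic sequence as multiplication by q ≢ 0. Cancelling the
-- irreducible factors of 𝒞 one at a time gives 𝒞 ∣ X^L − 1, i.e. L is a period, so c = L.
--
-- The facts about 𝔽ₚ[X] that rest on minimal-degree arguments (Euclid's lemma for irreducible
-- polynomials, existence of an irreducible factor) are proved in the double-negation monad;
-- the conclusions drawn from them are congruences modulo p, which are decidable.

module Submission where

open import Defs
open import Data.Nat as ℕ using (ℕ; zero; suc; NonZero; _≤_; _<_; z≤n; s≤s; _∸_; _!)
import Data.Nat.Properties as ℕP
import Data.Nat.Divisibility as ND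
open import Data.Nat.Divisibility using (_∣_)
open import Data.Nat.DivMod using (m/n*n≡m; _%_; _/_; m≡m%n+[m/n]*n; m%n<n)
open import Data.Nat.Primality using (Prime; euclidsLemma; prime⇒irreducible; prime⇒nonTrivial)
open import Data.Nat.Coprimality using (Coprime; coprime-Bézout)
open import Data.Nat.GCD using (gcd; module Bézout)
open import Data.Nat.LCM using (lcm; m∣lcm[m,n]; n∣lcm[m,n]; lcm-least; gcd*lcm)
open import Data.Nat.Combinatorics using (_C_; nCn≡1; nCk≡nC[n∸k]; k![n∸k]!∣n!)
open import Data.Nat.Combinatorics.Specification using (nCk≡n!/k![n-k]!)
open import Data.Fin as Fin using (Fin; toℕ; fromℕ; inject₁)
import Data.Fin.Properties as FP
open import Data.Integer as ℤ using (ℤ; +_; -[1+_]; _+_; _*_; -_; _-_; ∣_∣)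
import Data.Integer.Properties as ZP
open import Data.Integer.Divisibility using () renaming (_∣_ to _∣ℤ_)
open import Data.Integer.Divisibility.Signed as SD using (divides; ∣ᵤ⇒∣; ∣⇒∣ᵤ)
open import Data.Integer.Tactic.RingSolver
open import Data.List using (List; []; _∷_; _++_; [_]; map; reverse; replicate; length; _∷ʳ_)
import Data.List.Properties as LP
open import Data.List.Relation.Unary.All using (All; []; _∷_)
open import Data.List.Relation.Unary.Any using (Any; here; there)
open import Data.List.Relation.Unary.AllPairs using (AllPairs)
open import Data.List.Relation.Binary.Pointwise using (Pointwise; []; _∷_)
open import Data.Product using (Σ; _×_; _,_; proj₁; proj₂)
open import Data.Sum using (_⊎_; inj₁; inj₂; [_,_]′)
open import Data.Empty using (⊥; ⊥-elim)
open import Relation.Nullary using (¬_; Dec; yes; no; ¬¬-excluded-middle)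
open import Relation.Nullary.Negation using (¬¬-Monad)
open import Effect.Monad using (RawMonad)
open import Relation.Binary.Definitions using (tri<; tri≈; tri>)
open import Relation.Binary.Structures using (IsEquivalence)
open import Relation.Binary.PropositionalEquality using (_≡_; _≢_; refl; sym; trans; cong; cong₂; subst)
open Relation.Binary.PropositionalEquality.≡-Reasoning
open import Algebra.Bundles using (CommutativeRing; CommutativeSemiring; Semiring)
open import Algebra.Structures using (IsCommutativeRing)
import Algebra.Properties.CommutativeSemiring.Binomial as Bin
import Algebra.Properties.Semiring.Exp as Exp
import Algebra.Properties.Semiring.Mult as Mult
import Algebra.Properties.Semiring.Sum as Sum
import Level

open RawMonad (¬¬-Monad {Level.zero}) using (pure; _>>=_)

prime⇒2≤ : ∀ {p} → Prime p → 2 ≤ p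
prime⇒2≤ {p} pp = ℕ.nonTrivial⇒n>1 p {{prime⇒nonTrivial pp}}

p∤n! : ∀ p → Prime p → ∀ n → n < p → ¬ (p ND.∣ n !)
p∤n! p pp zero lt d = ℕP.<⇒≱ (prime⇒2≤ pp) (ND.∣⇒≤ d)
p∤n! p pp (suc n) lt d with euclidsLemma (suc n) (n !) pp d
... | inj₁ d1 = ℕP.<⇒≱ lt (ND.∣⇒≤ d1)
... | inj₂ d2 = p∤n! p pp n (ℕP.<-trans (ℕP.n<1+n n) lt) d2

p∣pCk : ∀ p → Prime p → ∀ k → 0 < k → k < p → p ND.∣ (p C k)
p∣pCk p pp k k>0 k<p with euclidsLemma (p C k) (k ! ℕ.* (p ∸ k) !) pp p∣prod
  where
    le : k ≤ p
    le = ℕP.<⇒≤ k<p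
    eq : (p C k) ℕ.* (k ! ℕ.* (p ∸ k) !) ≡ p !
    eq = trans (cong (ℕ._* (k ! ℕ.* (p ∸ k) !)) (nCk≡n!/k![n-k]! le))
        (m/n*n≡m {{ℕP._!*_!≢0 k (p ∸ k)}} (k![n∸k]!∣n! le))
    p∣p! : p ND.∣ p !
    p∣p! = lemma p (ℕP.≤-trans (ℕP.n≤1+n 1) (prime⇒2≤ pp))
      where lemma : ∀ n → 1 ≤ n → n ND.∣ n !
            lemma (suc n) _ = ND.m∣m*n (n !)
    p∣prod : p ND.∣ (p C k) ℕ.* (k ! ℕ.* (p ∸ k) !)
    p∣prod = subst (p ND.∣_) (sym eq) p∣p!
... | inj₁ d = d
... | inj₂ d with euclidsLemma (k !) ((p ∸ k) !) pp d
...   | inj₁ d1 = ⊥-elim (p∤n! p pp k k<p d1)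
...   | inj₂ d2 = ⊥-elim (p∤n! p pp (p ∸ k) (ℕP.∸-monoʳ-< k>0 (ℕP.<⇒≤ k<p)) d2)

lcm∣* : ∀ m n → lcm m n ∣ m ℕ.* n
lcm∣* m n = ND.divides (gcd m n) (sym (gcd*lcm m n))

Any-zip : ∀ {A B : Set} {P Q : A → Set} {R : A → B → Set} {S : B → Set} {xs ys} →
          (∀ {x y} → P x → Q x → R x y → S y) → Any P xs → All Q xs → Pointwise R xs ys → Any S ys
Any-zip f (here px) (qx ∷ _) (rxy ∷ _) = here (f px qx rxy)
Any-zip f (there pxs) (_ ∷ qxs) (_ ∷ rxys) = there (Any-zip f pxs qxs rxys)

Least : (ℕ → Set) → ℕ → Set
Least P m = P m × (∀ k → k < m → ¬ P k)

least-witness-≤ : ∀ (P : ℕ → Set) N n → n ≤ N → P n → ¬ ¬ (Σ ℕ (Least P))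
least-witness-≤ P zero zero le pn = pure (zero , pn , λ k ())
least-witness-≤ P (suc N) n le pn = ¬¬-excluded-middle {A = Σ ℕ λ k → k < n × P k} >>= λ
  { (yes (k , lt , pk)) → least-witness-≤ P N k (ℕP.≤-pred (ℕP.≤-trans lt le)) pk
  ; (no nk) → pure (n , pn , λ k lt pk → nk (k , lt , pk)) }

least-witness : ∀ (P : ℕ → Set) n → P n → ¬ ¬ (Σ ℕ (Least P))
least-witness P n pn = least-witness-≤ P n n ℕP.≤-refl pn

-- Polynomials over ℤ, up to coefficientwise equality

Poly : Set
Poly = List ℤ

infix 4 _≐_

record _≐_ (f g : Poly) : Set where
  constructor mk≐
  field at≐ : ∀ i → coeff f i ≡ coeff g i
open _≐_ public

neg : Poly → Poly
neg = map (λ x → - x)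

scale : ℤ → Poly → Poly
scale a = map (a *_)

infixl 6 _⊕_ _⊝_

infixl 7 _⊗_

_⊕_ : Poly → Poly → Poly
_⊕_ = _+ₚ_

_⊗_ : Poly → Poly → Poly
_⊗_ = _*ₚ_

_⊝_ : Poly → Poly → Poly
f ⊝ g = f ⊕ neg g

coeff-⊕ : ∀ f g i → coeff (f ⊕ g) i ≡ coeff f i + coeff g i
coeff-⊕ [] g i = sym (ZP.+-identityˡ _)
coeff-⊕ (a ∷ f) [] i = sym (ZP.+-identityʳ _)
coeff-⊕ (a ∷ f) (b ∷ g) zero = refl
coeff-⊕ (a ∷ f) (b ∷ g) (suc i) = coeff-⊕ f g i

coeff-scale : ∀ a f i → coeff (scale a f) i ≡ a * coeff f i
coeff-scale a [] i = sym (ZP.*-zeroʳ a)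
coeff-scale a (x ∷ f) zero = refl
coeff-scale a (x ∷ f) (suc i) = coeff-scale a f i

coeff-neg : ∀ f i → coeff (neg f) i ≡ - coeff f i
coeff-neg [] i = refl
coeff-neg (x ∷ f) zero = refl
coeff-neg (x ∷ f) (suc i) = coeff-neg f i

coeff-⊗ : ∀ a f g i → coeff ((a ∷ f) ⊗ g) i ≡ a * coeff g i + coeff (+ 0 ∷ (f ⊗ g)) i
coeff-⊗ a f g i =
  trans (coeff-⊕ (scale a g) (+ 0 ∷ (f ⊗ g)) i)
    (cong (_+ coeff (+ 0 ∷ (f ⊗ g)) i) (coeff-scale a g i))

≐-refl : ∀ {f} → f ≐ f
≐-refl = mk≐ λ i → refl

≐-sym : ∀ {f g} → f ≐ g → g ≐ f
≐-sym e = mk≐ λ i → sym (at≐ e i)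

≐-trans : ∀ {f g h} → f ≐ g → g ≐ h → f ≐ h
≐-trans e e' = mk≐ λ i → trans (at≐ e i) (at≐ e' i)

⊕-cong≐ : ∀ {f f' g g'} → f ≐ f' → g ≐ g' → f ⊕ g ≐ f' ⊕ g'
⊕-cong≐ {f} {f'} {g} {g'} e e' = mk≐ λ i → trans (coeff-⊕ f g i)
    (trans (cong₂ _+_ (at≐ e i) (at≐ e' i)) (sym (coeff-⊕ f' g' i)))

coeff-∷-cong : ∀ {a b f g} → a ≡ b → f ≐ g → ∀ i → coeff (a ∷ f) i ≡ coeff (b ∷ g) i
coeff-∷-cong e e' zero = e
coeff-∷-cong e e' (suc i) = at≐ e' i

∷-cong≐ : ∀ {a b f g} → a ≡ b → f ≐ g → (a ∷ f) ≐ (b ∷ g)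
∷-cong≐ e e' = mk≐ (coeff-∷-cong e e')

scale-cong≐ : ∀ a {f g} → f ≐ g → scale a f ≐ scale a g
scale-cong≐ a {f} {g} e = mk≐ λ i → trans (coeff-scale a f i)
    (trans (cong (a *_) (at≐ e i)) (sym (coeff-scale a g i)))

tail≐ : ∀ {a b f g} → (a ∷ f) ≐ (b ∷ g) → f ≐ g
tail≐ e = mk≐ λ j → at≐ e (suc j)

⊗-zero≐ : ∀ {f} g → f ≐ [] → f ⊗ g ≐ []
⊗-zero≐ {[]} g e = ≐-refl
⊗-zero≐ {b ∷ f'} g e = mk≐ λ i → trans (coeff-⊗ b f' g i)
    (trans (cong₂ _+_ (trans (cong (_* coeff g i) (at≐ e 0)) (ZP.*-zeroˡ (coeff g i))) (l i))
      (ZP.+-identityˡ _))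
  where
    ih : f' ⊗ g ≐ []
    ih = ⊗-zero≐ {f'} g (mk≐ λ j → at≐ e (suc j))
    l : ∀ i → coeff (+ 0 ∷ (f' ⊗ g)) i ≡ + 0
    l zero = refl
    l (suc i) = at≐ ih i

⊗-congˡ≐ : ∀ {f f'} g → f ≐ f' → f ⊗ g ≐ f' ⊗ g
⊗-congˡ≐ {[]} {f'} g e = ≐-sym (⊗-zero≐ g (≐-sym e))
⊗-congˡ≐ {a ∷ f} {[]} g e = ⊗-zero≐ g e
⊗-congˡ≐ {a ∷ f} {b ∷ f'} g e = mk≐ λ i → trans (coeff-⊗ a f g i)
    (trans (cong₂ _+_ (cong (_* coeff g i) (at≐ e 0)) (coeff-∷-cong refl (⊗-congˡ≐ g (tail≐ e)) i))
      (sym (coeff-⊗ b f' g i)))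

coeff-⊗-zeroʳ : ∀ f i → coeff (f ⊗ []) i ≡ + 0
coeff-⊗-zeroʳ [] i = refl
coeff-⊗-zeroʳ (a ∷ f) zero = trans (coeff-⊗ a f [] zero) (trans (cong (_+ + 0) (ZP.*-zeroʳ a)) refl)
coeff-⊗-zeroʳ (a ∷ f) (suc i) = trans (coeff-⊗ a f [] (suc i))
    (trans (cong₂ _+_ (ZP.*-zeroʳ a) (coeff-⊗-zeroʳ f i)) refl)

⊗-zeroʳ≐ : ∀ f → f ⊗ [] ≐ []
⊗-zeroʳ≐ f = mk≐ (coeff-⊗-zeroʳ f)

coeff-⊗-∷ʳ : ∀ f b g i → coeff (f ⊗ (b ∷ g)) i ≡ coeff (scale b f ⊕ (+ 0 ∷ (f ⊗ g))) i
coeff-⊗-∷ʳ [] b g i = sym (trans (coeff-⊕ [] (+ 0 ∷ []) i) (l i))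
  where l : ∀ i → + 0 + coeff (+ 0 ∷ []) i ≡ + 0
        l zero = refl
        l (suc i) = refl
coeff-⊗-∷ʳ (a ∷ f) b g zero = trans (coeff-⊗ a f (b ∷ g) zero)
    (trans (cong (_+ + 0) (ZP.*-comm a b))
      (sym (trans (coeff-⊕ (scale b (a ∷ f)) (+ 0 ∷ ((a ∷ f) ⊗ g)) zero) refl)))
coeff-⊗-∷ʳ (a ∷ f) b g (suc i) = begin
    coeff ((a ∷ f) ⊗ (b ∷ g)) (suc i)
  ≡⟨ coeff-⊗ a f (b ∷ g) (suc i) ⟩
    a * coeff g i + coeff (f ⊗ (b ∷ g)) i
  ≡⟨ cong (_+_ (a * coeff g i)) (coeff-⊗-∷ʳ f b g i) ⟩
    a * coeff g i + coeff (scale b f ⊕ (+ 0 ∷ (f ⊗ g))) i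
  ≡⟨ cong (_+_ (a * coeff g i))
      (trans (coeff-⊕ (scale b f) (+ 0 ∷ (f ⊗ g)) i)
        (cong (_+ coeff (+ 0 ∷ (f ⊗ g)) i) (coeff-scale b f i))) ⟩
    a * coeff g i + (b * coeff f i + coeff (+ 0 ∷ (f ⊗ g)) i)
  ≡⟨ l (a * coeff g i) (b * coeff f i) (coeff (+ 0 ∷ (f ⊗ g)) i) ⟩
    b * coeff f i + (a * coeff g i + coeff (+ 0 ∷ (f ⊗ g)) i)
  ≡⟨ cong (_+_ (b * coeff f i)) (sym (coeff-⊗ a f g i)) ⟩
    b * coeff f i + coeff ((a ∷ f) ⊗ g) i
  ≡⟨ cong (_+ coeff ((a ∷ f) ⊗ g) i) (sym (coeff-scale b f i)) ⟩
    coeff (scale b f) i + coeff ((a ∷ f) ⊗ g) i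
  ≡⟨ sym (coeff-⊕ (scale b (a ∷ f)) (+ 0 ∷ ((a ∷ f) ⊗ g)) (suc i)) ⟩
    coeff (scale b (a ∷ f) ⊕ (+ 0 ∷ ((a ∷ f) ⊗ g))) (suc i) ∎
  where l : ∀ x y z → x + (y + z) ≡ y + (x + z)
        l = solve-∀

⊗-comm≐ : ∀ f g → f ⊗ g ≐ g ⊗ f
⊗-comm≐ [] g = ≐-sym (⊗-zeroʳ≐ g)
⊗-comm≐ (a ∷ f) g = mk≐ λ i → trans (coeff-⊕ (scale a g) (+ 0 ∷ (f ⊗ g)) i)
    (trans (cong (_+_ (coeff (scale a g) i)) (coeff-∷-cong refl (⊗-comm≐ f g) i))
      (trans (sym (coeff-⊕ (scale a g) (+ 0 ∷ (g ⊗ f)) i)) (sym (coeff-⊗-∷ʳ g a f i))))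

coeff-⊗-distribʳ : ∀ f f' g i → coeff ((f ⊕ f') ⊗ g) i ≡ coeff (f ⊗ g ⊕ f' ⊗ g) i
coeff-⊗-distribʳ [] f' g i = refl
coeff-⊗-distribʳ (a ∷ f) [] g i = sym (trans (coeff-⊕ ((a ∷ f) ⊗ g) [] i) (ZP.+-identityʳ _))
coeff-⊗-distribʳ (a ∷ f) (b ∷ f') g i = begin
    coeff (((a + b) ∷ (f ⊕ f')) ⊗ g) i
  ≡⟨ coeff-⊗ (a + b) (f ⊕ f') g i ⟩
    (a + b) * coeff g i + coeff (+ 0 ∷ ((f ⊕ f') ⊗ g)) i
  ≡⟨ cong (_+_ ((a + b) * coeff g i)) (coeff-∷-cong refl (mk≐ (coeff-⊗-distribʳ f f' g)) i) ⟩
    (a + b) * coeff g i + coeff (+ 0 ∷ (f ⊗ g ⊕ f' ⊗ g)) i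
  ≡⟨ cong (_+_ ((a + b) * coeff g i)) (l2 i) ⟩
    (a + b) * coeff g i + (coeff (+ 0 ∷ (f ⊗ g)) i + coeff (+ 0 ∷ (f' ⊗ g)) i)
  ≡⟨ l (a) b (coeff g i) (coeff (+ 0 ∷ (f ⊗ g)) i) (coeff (+ 0 ∷ (f' ⊗ g)) i) ⟩
    (a * coeff g i + coeff (+ 0 ∷ (f ⊗ g)) i) + (b * coeff g i + coeff (+ 0 ∷ (f' ⊗ g)) i)
  ≡⟨ sym (cong₂ _+_ (coeff-⊗ a f g i) (coeff-⊗ b f' g i)) ⟩
    coeff ((a ∷ f) ⊗ g) i + coeff ((b ∷ f') ⊗ g) i
  ≡⟨ sym (coeff-⊕ ((a ∷ f) ⊗ g) ((b ∷ f') ⊗ g) i) ⟩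
    coeff ((a ∷ f) ⊗ g ⊕ (b ∷ f') ⊗ g) i ∎
  where l : ∀ a b x y z → (a + b) * x + (y + z) ≡ (a * x + y) + (b * x + z)
        l = solve-∀
        l2 :
            ∀ i → coeff (+ 0 ∷ (f ⊗ g ⊕ f' ⊗ g)) i ≡ coeff (+ 0 ∷ (f ⊗ g)) i + coeff (+ 0 ∷ (f' ⊗ g)) i
        l2 zero = refl
        l2 (suc i) = coeff-⊕ (f ⊗ g) (f' ⊗ g) i

⊗-distribʳ≐ : ∀ f f' g → (f ⊕ f') ⊗ g ≐ f ⊗ g ⊕ f' ⊗ g
⊗-distribʳ≐ f f' g = mk≐ (coeff-⊗-distribʳ f f' g)

coeff-scale-⊗ : ∀ a f g i → coeff (scale a f ⊗ g) i ≡ coeff (scale a (f ⊗ g)) i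
coeff-scale-⊗ a [] g i = refl
coeff-scale-⊗ a (x ∷ f) g i = begin
    coeff ((a * x ∷ scale a f) ⊗ g) i
  ≡⟨ coeff-⊗ (a * x) (scale a f) g i ⟩
    a * x * coeff g i + coeff (+ 0 ∷ (scale a f ⊗ g)) i
  ≡⟨ cong (_+_ (a * x * coeff g i)) (coeff-∷-cong refl (mk≐ (coeff-scale-⊗ a f g)) i) ⟩
    a * x * coeff g i + coeff (+ 0 ∷ scale a (f ⊗ g)) i
  ≡⟨ cong (_+_ (a * x * coeff g i)) (l2 i) ⟩
    a * x * coeff g i + a * coeff (+ 0 ∷ (f ⊗ g)) i
  ≡⟨ l a x (coeff g i) (coeff (+ 0 ∷ (f ⊗ g)) i) ⟩
    a * (x * coeff g i + coeff (+ 0 ∷ (f ⊗ g)) i)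
  ≡⟨ cong (a *_) (sym (coeff-⊗ x f g i)) ⟩
    a * coeff ((x ∷ f) ⊗ g) i
  ≡⟨ sym (coeff-scale a ((x ∷ f) ⊗ g) i) ⟩
    coeff (scale a ((x ∷ f) ⊗ g)) i ∎
  where l : ∀ a x y z → a * x * y + a * z ≡ a * (x * y + z)
        l = solve-∀
        l2 : ∀ i → coeff (+ 0 ∷ scale a (f ⊗ g)) i ≡ a * coeff (+ 0 ∷ (f ⊗ g)) i
        l2 zero = sym (ZP.*-zeroʳ a)
        l2 (suc i) = coeff-scale a (f ⊗ g) i

scale-⊗≐ : ∀ a f g → scale a f ⊗ g ≐ scale a (f ⊗ g)
scale-⊗≐ a f g = mk≐ (coeff-scale-⊗ a f g)

0∷-⊗≐ : ∀ f g → (+ 0 ∷ f) ⊗ g ≐ + 0 ∷ (f ⊗ g)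
0∷-⊗≐ f g = mk≐ λ i → trans (coeff-⊗ (+ 0) f g i)
    (trans (cong (_+ coeff (+ 0 ∷ (f ⊗ g)) i) (ZP.*-zeroˡ (coeff g i))) (ZP.+-identityˡ _))

⊗-assoc≐ : ∀ f g h → (f ⊗ g) ⊗ h ≐ f ⊗ (g ⊗ h)
⊗-assoc≐ [] g h = ≐-refl
⊗-assoc≐ (a ∷ f) g h = ≐-trans (⊗-distribʳ≐ (scale a g) (+ 0 ∷ (f ⊗ g)) h)
  (⊕-cong≐ (scale-⊗≐ a g h) (≐-trans (0∷-⊗≐ (f ⊗ g) h) (∷-cong≐ refl (⊗-assoc≐ f g h))))

⊕-assoc≐ : ∀ f g h → (f ⊕ g) ⊕ h ≐ f ⊕ (g ⊕ h)
⊕-assoc≐ f g h = mk≐ λ i → trans (coeff-⊕ (f ⊕ g) h i)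
    (trans (cong (_+ coeff h i) (coeff-⊕ f g i))
      (trans (ZP.+-assoc (coeff f i) (coeff g i) (coeff h i))
        (trans (cong (_+_ (coeff f i)) (sym (coeff-⊕ g h i))) (sym (coeff-⊕ f (g ⊕ h) i)))))

⊕-comm≐ : ∀ f g → f ⊕ g ≐ g ⊕ f
⊕-comm≐ f g = mk≐ λ i → trans (coeff-⊕ f g i)
    (trans (ZP.+-comm (coeff f i) (coeff g i)) (sym (coeff-⊕ g f i)))

⊕-idˡ≐ : ∀ f → [] ⊕ f ≐ f
⊕-idˡ≐ f = ≐-refl

⊕-idʳ≐ : ∀ f → f ⊕ [] ≐ f
⊕-idʳ≐ f = mk≐ λ i → trans (coeff-⊕ f [] i) (ZP.+-identityʳ _)

⊕-invˡ≐ : ∀ f → neg f ⊕ f ≐ []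
⊕-invˡ≐ f = mk≐ λ i → trans (coeff-⊕ (neg f) f i)
    (trans (cong (_+ coeff f i) (coeff-neg f i)) (ZP.+-inverseˡ (coeff f i)))

⊕-invʳ≐ : ∀ f → f ⊕ neg f ≐ []
⊕-invʳ≐ f = ≐-trans (⊕-comm≐ f (neg f)) (⊕-invˡ≐ f)

one : Poly
one = + 1 ∷ []

⊗-idˡ≐ : ∀ f → one ⊗ f ≐ f
⊗-idˡ≐ f = mk≐ λ i → trans (coeff-⊗ (+ 1) [] f i)
    (trans (cong (_+ coeff (+ 0 ∷ []) i) (ZP.*-identityˡ (coeff f i))) (l i))
  where l : ∀ i → coeff f i + coeff (+ 0 ∷ []) i ≡ coeff f i
        l zero = ZP.+-identityʳ _
        l (suc i) = ZP.+-identityʳ _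

neg≐scale : ∀ f → neg f ≐ scale (- + 1) f
neg≐scale f = mk≐ λ i → trans (coeff-neg f i)
    (trans (sym (ZP.-1*i≡-i (coeff f i))) (sym (coeff-scale (- + 1) f i)))

⊗-scale≐ : ∀ a f g → f ⊗ scale a g ≐ scale a (f ⊗ g)
⊗-scale≐ a f g = ≐-trans (⊗-comm≐ f (scale a g))
    (≐-trans (scale-⊗≐ a g f) (scale-cong≐ a (⊗-comm≐ g f)))

⊗-congʳ≐ : ∀ f {g g'} → g ≐ g' → f ⊗ g ≐ f ⊗ g'
⊗-congʳ≐ f {g} {g'} e = ≐-trans (⊗-comm≐ f g) (≐-trans (⊗-congˡ≐ f e) (⊗-comm≐ g' f))

⊗-distribˡ≐ : ∀ f g h → f ⊗ (g ⊕ h) ≐ f ⊗ g ⊕ f ⊗ h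
⊗-distribˡ≐ f g h = ≐-trans (⊗-comm≐ f (g ⊕ h))
    (≐-trans (⊗-distribʳ≐ g h f) (⊕-cong≐ (⊗-comm≐ g f) (⊗-comm≐ h f)))

⊗-neg≐ : ∀ f g → f ⊗ neg g ≐ neg (f ⊗ g)
⊗-neg≐ f g = ≐-trans (⊗-congʳ≐ f (neg≐scale g))
    (≐-trans (⊗-scale≐ (- + 1) f g) (≐-sym (neg≐scale (f ⊗ g))))

⊝⊕≐ : ∀ g w → (g ⊕ neg w) ⊕ w ≐ g
⊝⊕≐ g w = mk≐ λ i → trans (coeff-⊕ (g ⊕ neg w) w i)
    (trans
      (cong (_+ coeff w i) (trans (coeff-⊕ g (neg w) i) (cong (_+_ (coeff g i)) (coeff-neg w i))))
      (l (coeff g i) (coeff w i)))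
  where l : ∀ a b → a + - b + b ≡ a
        l = solve-∀

scale-⊕≐ : ∀ a f g → scale a (f ⊕ g) ≐ scale a f ⊕ scale a g
scale-⊕≐ a f g = mk≐ λ i → trans (coeff-scale a (f ⊕ g) i)
    (trans (cong (a *_) (coeff-⊕ f g i))
      (trans (ZP.*-distribˡ-+ a (coeff f i) (coeff g i))
        (sym
          (trans (coeff-⊕ (scale a f) (scale a g) i)
            (cong₂ _+_ (coeff-scale a f i) (coeff-scale a g i))))))

neg-⊕≐ : ∀ f g → neg (f ⊕ g) ≐ neg f ⊕ neg g
neg-⊕≐ f g = mk≐ λ i → trans (coeff-neg (f ⊕ g) i)
    (trans (cong -_ (coeff-⊕ f g i))
      (trans (ZP.neg-distrib-+ (coeff f i) (coeff g i))
        (sym (trans (coeff-⊕ (neg f) (neg g) i) (cong₂ _+_ (coeff-neg f i) (coeff-neg g i))))))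

neg-⊗≐ : ∀ f g → neg f ⊗ g ≐ neg (f ⊗ g)
neg-⊗≐ f g = ≐-trans (⊗-comm≐ (neg f) g)
    (≐-trans (⊗-neg≐ g f)
      (mk≐ λ i → trans (coeff-neg (g ⊗ f) i)
        (trans (cong -_ (at≐ (⊗-comm≐ g f) i)) (sym (coeff-neg (f ⊗ g) i)))))

⊕-interchange≐ : ∀ a b c d → (a ⊕ b) ⊕ (c ⊕ d) ≐ (a ⊕ c) ⊕ (b ⊕ d)
⊕-interchange≐ a b c d = mk≐ λ i → trans (coeff-⊕ (a ⊕ b) (c ⊕ d) i)
    (trans (cong₂ _+_ (coeff-⊕ a b i) (coeff-⊕ c d i))
      (trans (l (coeff a i) (coeff b i) (coeff c i) (coeff d i))
        (sym (trans (coeff-⊕ (a ⊕ c) (b ⊕ d) i) (cong₂ _+_ (coeff-⊕ a c i) (coeff-⊕ b d i))))))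
  where l : ∀ a b c d → (a + b) + (c + d) ≡ (a + c) + (b + d)
        l = solve-∀

telescope≐ : ∀ a o b → (a ⊕ neg o) ⊕ (b ⊕ neg a) ≐ b ⊕ neg o
telescope≐ a o b = mk≐ λ i → trans (coeff-⊕ (a ⊕ neg o) (b ⊕ neg a) i)
    (trans
      (cong₂ _+_ (trans (coeff-⊕ a (neg o) i) (cong (_+_ (coeff a i)) (coeff-neg o i)))
        (trans (coeff-⊕ b (neg a) i) (cong (_+_ (coeff b i)) (coeff-neg a i))))
      (trans (l (coeff a i) (coeff o i) (coeff b i))
        (sym (trans (coeff-⊕ b (neg o) i) (cong (_+_ (coeff b i)) (coeff-neg o i))))))
  where l : ∀ a o b → (a + - o) + (b + - a) ≡ b + - o
        l = solve-∀

Xpow : ℕ → Poly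
Xpow n = replicate n (+ 0) ++ [ + 1 ]

shift : ℕ → Poly → Poly
shift n f = replicate n (+ 0) ++ f

coeff-shift-hi : ∀ k f i → coeff (shift k f) (k ℕ.+ i) ≡ coeff f i
coeff-shift-hi zero f i = refl
coeff-shift-hi (suc k) f i = coeff-shift-hi k f i

coeff-shift : ∀ k f i → k ≤ i → coeff (shift k f) i ≡ coeff f (i ∸ k)
coeff-shift k f i le = trans (cong (coeff (shift k f)) (sym (ℕP.m+[n∸m]≡n le)))
    (coeff-shift-hi k f (i ∸ k))

Xpow⊗≐ : ∀ k g → Xpow k ⊗ g ≐ shift k g
Xpow⊗≐ zero g = ⊗-idˡ≐ g
Xpow⊗≐ (suc k) g = ≐-trans (0∷-⊗≐ (Xpow k) g) (∷-cong≐ refl (Xpow⊗≐ k g))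

shift-Xpow : ∀ k n → shift k (Xpow n) ≡ Xpow (k ℕ.+ n)
shift-Xpow zero n = refl
shift-Xpow (suc k) n = cong (+ 0 ∷_) (shift-Xpow k n)

Xpow-+≐ : ∀ k n → Xpow k ⊗ Xpow n ≐ Xpow (k ℕ.+ n)
Xpow-+≐ k n = subst (λ w → Xpow k ⊗ Xpow n ≐ w) (shift-Xpow k n) (Xpow⊗≐ k (Xpow n))

Xpow-1 : ℕ → Poly
Xpow-1 c = Xpow c ⊕ neg one

Xpow-1-⊗-Xpow≐ : ∀ L m → Xpow-1 L ⊗ Xpow m ≐ Xpow (L ℕ.+ m) ⊕ neg (Xpow m)
Xpow-1-⊗-Xpow≐ L m = ≐-trans (⊗-distribʳ≐ (Xpow L) (neg one) (Xpow m))
    (⊕-cong≐ (Xpow-+≐ L m)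
      (≐-trans (neg-⊗≐ one (Xpow m))
        (mk≐ λ i → trans (coeff-neg (one ⊗ Xpow m) i)
          (trans (cong -_ (at≐ (⊗-idˡ≐ (Xpow m)) i)) (sym (coeff-neg (Xpow m) i))))))

Xpow-1-0≐ : Xpow-1 0 ≐ []
Xpow-1-0≐ = mk≐ λ { zero → refl ; (suc i) → refl }

geomSum : ℕ → ℕ → Poly
geomSum L zero = []
geomSum L (suc j) = geomSum L j ⊕ Xpow (j ℕ.* L)

Xpow-1-⊗-geomSum≐ : ∀ L j → Xpow-1 L ⊗ geomSum L j ≐ Xpow-1 (j ℕ.* L)
Xpow-1-⊗-geomSum≐ L zero = ≐-trans (⊗-zeroʳ≐ (Xpow-1 L)) (≐-sym Xpow-1-0≐)
Xpow-1-⊗-geomSum≐ L (suc j) = ≐-trans (⊗-distribˡ≐ (Xpow-1 L) (geomSum L j) (Xpow (j ℕ.* L)))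
    (≐-trans (⊕-cong≐ (Xpow-1-⊗-geomSum≐ L j) (Xpow-1-⊗-Xpow≐ L (j ℕ.* L)))
      (telescope≐ (Xpow (j ℕ.* L)) one (Xpow (L ℕ.+ j ℕ.* L))))

coeff-++ : ∀ l r i → coeff (l ++ r) (length l ℕ.+ i) ≡ coeff r i
coeff-++ [] r i = refl
coeff-++ (x ∷ l) r i = coeff-++ l r i

coeff-++ˡ : ∀ l r i → i < length l → coeff (l ++ r) i ≡ coeff l i
coeff-++ˡ (x ∷ l) r zero lt = refl
coeff-++ˡ (x ∷ l) r (suc i) (s≤s lt) = coeff-++ˡ l r i lt

length-monic : ∀ s → length (monicPoly s) ≡ suc (length s)
length-monic s = trans (LP.length-++ (reverse (map -_ s)))
    (trans (ℕP.+-comm _ 1) (cong suc (trans (LP.length-reverse (map -_ s)) (LP.length-map -_ s))))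

lc-monic : ∀ s → coeff (monicPoly s) (length s) ≡ + 1
lc-monic s = trans
    (cong (coeff (monicPoly s))
      (sym (trans (ℕP.+-identityʳ _) (trans (LP.length-reverse (map -_ s)) (LP.length-map -_ s)))))
    (coeff-++ (reverse (map -_ s)) [ + 1 ] 0)

coeff₀-⊗ : ∀ f g → coeff (f ⊗ g) 0 ≡ coeff f 0 * coeff g 0
coeff₀-⊗ [] g = refl
coeff₀-⊗ (a ∷ f) g = trans (coeff-⊗ a f g 0) (ZP.+-identityʳ _)

coeff₀-monicPoly-∷ʳ : ∀ rs tk → coeff (monicPoly (rs ∷ʳ tk)) 0 ≡ - tk
coeff₀-monicPoly-∷ʳ rs tk = cong (λ z → coeff (z ++ [ + 1 ]) 0)
    (trans (cong reverse (LP.map-++ (-_) rs [ tk ])) (LP.reverse-++ (map (-_) rs) [ - tk ]))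

length-∷ʳ : ∀ (rs : List ℤ) tk → length (rs ∷ʳ tk) ≡ suc (length rs)
length-∷ʳ rs tk = trans (LP.length-++ rs) (ℕP.+-comm (length rs) 1)

trunc : ℕ → Poly → Poly
trunc zero f = []
trunc (suc d) [] = + 0 ∷ trunc d []
trunc (suc d) (x ∷ f) = x ∷ trunc d f

length-trunc : ∀ d f → length (trunc d f) ≡ d
length-trunc zero f = refl
length-trunc (suc d) [] = cong suc (length-trunc d [])
length-trunc (suc d) (x ∷ f) = cong suc (length-trunc d f)

coeff-trunc : ∀ d f i → i < d → coeff (trunc d f) i ≡ coeff f i
coeff-trunc (suc d) [] zero lt = refl
coeff-trunc (suc d) [] (suc i) (s≤s lt) = coeff-trunc d [] i lt
coeff-trunc (suc d) (x ∷ f) zero lt = refl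
coeff-trunc (suc d) (x ∷ f) (suc i) (s≤s lt) = coeff-trunc d f i lt

map-neg-neg : ∀ l → map (-_) (map (-_) l) ≡ l
map-neg-neg [] = refl
map-neg-neg (x ∷ l) = cong₂ _∷_ (ZP.neg-involutive x) (map-neg-neg l)

recurrenceOf : Poly → ℕ → List ℤ
recurrenceOf f d = reverse (map (-_) (trunc d f))

monicPoly-recurrenceOf : ∀ f d → monicPoly (recurrenceOf f d) ≡ trunc d f ++ [ + 1 ]
monicPoly-recurrenceOf f d = cong (_++ [ + 1 ])
    (trans (sym (LP.reverse-map (-_) (reverse (map (-_) (trunc d f)))))
      (trans (cong (map (-_)) (LP.reverse-involutive (map (-_) (trunc d f))))
        (map-neg-neg (trunc d f))))

length-recurrenceOf : ∀ f d → length (recurrenceOf f d) ≡ d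
length-recurrenceOf f d = trans (LP.length-reverse (map (-_) (trunc d f)))
    (trans (LP.length-map (-_) (trunc d f)) (length-trunc d f))

-- Polynomials acting on sequences

Seq : Set
Seq = ℕ → ℤ

act : Poly → Seq → Seq
act [] x n = + 0
act (a ∷ f) x n = a * x n + act f x (suc n)

act-⊕ : ∀ f g x n → act (f ⊕ g) x n ≡ act f x n + act g x n
act-⊕ [] g x n = sym (ZP.+-identityˡ _)
act-⊕ (a ∷ f) [] x n = sym (ZP.+-identityʳ _)
act-⊕ (a ∷ f) (b ∷ g) x n = trans (cong (_+_ ((a + b) * x n)) (act-⊕ f g x (suc n)))
    (l a b (x n) (act f x (suc n)) (act g x (suc n)))
  where l : ∀ a b x u v → (a + b) * x + (u + v) ≡ (a * x + u) + (b * x + v)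
        l = solve-∀

act-scale : ∀ a f x n → act (scale a f) x n ≡ a * act f x n
act-scale a [] x n = sym (ZP.*-zeroʳ a)
act-scale a (b ∷ f) x n = trans (cong (_+_ (a * b * x n)) (act-scale a f x (suc n)))
    (l a b (x n) (act f x (suc n)))
  where l : ∀ a b x u → a * b * x + a * u ≡ a * (b * x + u)
        l = solve-∀

act-neg : ∀ f x n → act (neg f) x n ≡ - act f x n
act-neg [] x n = refl
act-neg (b ∷ f) x n = trans (cong (_+_ (- b * x n)) (act-neg f x (suc n)))
    (l b (x n) (act f x (suc n)))
  where l : ∀ b x u → - b * x + - u ≡ - (b * x + u)
        l = solve-∀

act-0∷ : ∀ f x n → act (+ 0 ∷ f) x n ≡ act f x (suc n)
act-0∷ f x n = ZP.+-identityˡ _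

act-⊗ : ∀ f g x n → act (f ⊗ g) x n ≡ act f (act g x) n
act-⊗ [] g x n = refl
act-⊗ (a ∷ f) g x n = trans (act-⊕ (scale a g) (+ 0 ∷ (f ⊗ g)) x n)
    (cong₂ _+_ (act-scale a g x n) (trans (act-0∷ (f ⊗ g) x n) (act-⊗ f g x (suc n))))

act-Xpow : ∀ k x n → act (Xpow k) x n ≡ x (n ℕ.+ k)
act-Xpow zero x n = trans (cong (_+ + 0) (ZP.*-identityˡ (x n)))
    (trans (ZP.+-identityʳ _) (cong x (sym (ℕP.+-identityʳ n))))
act-Xpow (suc k) x n = trans (act-0∷ (Xpow k) x n)
    (trans (act-Xpow k x (suc n)) (cong x (sym (ℕP.+-suc n k))))

act-Xpow-1 : ∀ c x n → act (Xpow-1 c) x n ≡ x (n ℕ.+ c) + - x n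
act-Xpow-1 c x n = trans (act-⊕ (Xpow c) (neg one) x n)
    (cong₂ _+_ (act-Xpow c x n)
      (trans (act-neg one x n) (cong -_ (trans (ZP.+-identityʳ _) (ZP.*-identityˡ _)))))

act-++ : ∀ l r x n → act (l ++ r) x n ≡ act l x n + act r x (n ℕ.+ length l)
act-++ [] r x n = trans (cong (act r x) (sym (ℕP.+-identityʳ n))) (sym (ZP.+-identityˡ _))
act-++ (a ∷ l) r x n = trans
    (cong (_+_ (a * x n))
      (trans (act-++ l r x (suc n))
        (cong (λ k → act l x (suc n) + act r x k) (sym (ℕP.+-suc n (length l))))))
    (sym (ZP.+-assoc (a * x n) _ _))

act-shift : ∀ f (x : Seq) m c → act f x (m ℕ.+ c) ≡ act f (λ i → x (i ℕ.+ c)) m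
act-shift [] x m c = refl
act-shift (a ∷ f) x m c = cong (_+_ (a * x (m ℕ.+ c))) (act-shift f x (suc m) c)

shiftSum : ℕ → ℕ → Seq → ℕ → ℤ
shiftSum L zero x n = + 0
shiftSum L (suc j) x n = shiftSum L j x n + x (n ℕ.+ j ℕ.* L)

act-geomSum : ∀ L j x n → act (geomSum L j) x n ≡ shiftSum L j x n
act-geomSum L zero x n = refl
act-geomSum L (suc j) x n = trans (act-⊕ (geomSum L j) (Xpow (j ℕ.* L)) x n)
    (cong₂ _+_ (act-geomSum L j x n) (act-Xpow (j ℕ.* L) x n))

dot-neg : ∀ s w → dot (map -_ s) w ≡ - dot s w
dot-neg [] w = refl
dot-neg (a ∷ s) [] = refl
dot-neg (a ∷ s) (b ∷ w) = trans (cong (_+_ (- a * b)) (dot-neg s w)) (l a b (dot s w))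
  where l : ∀ a b u → - a * b + - u ≡ - (a * b + u)
        l = solve-∀

act-rev :
    ∀ (y : Seq) l w n → length w ≡ length l → (∀ j → j < length l → coeff w j ≡ y (n ℕ.+ (length l ∸ suc j)))
    → act (reverse l) y n ≡ dot l w
act-rev y [] [] n _ h = refl
act-rev y (a ∷ l) (b ∷ w) n len h = begin
    act (reverse (a ∷ l)) y n
  ≡⟨ cong (λ z → act z y n) (LP.unfold-reverse a l) ⟩
    act (reverse l ++ [ a ]) y n
  ≡⟨ act-++ (reverse l) [ a ] y n ⟩
    act (reverse l) y n + act [ a ] y (n ℕ.+ length (reverse l))
  ≡⟨ cong₂ _+_ (act-rev y l w n (ℕP.suc-injective len) (λ j lt → h (suc j) (s≤s lt)))
      (trans (ZP.+-identityʳ _)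
        (cong (a *_)
          (trans (cong (λ k → y (n ℕ.+ k)) (trans (LP.length-reverse l) refl)) (sym (h 0 (s≤s z≤n))))
            )) ⟩
    dot l w + a * b
  ≡⟨ ZP.+-comm (dot l w) (a * b) ⟩
    dot (a ∷ l) (b ∷ w) ∎

coeff-dropLast : ∀ l j → suc j < length l → coeff (dropLast l) j ≡ coeff l j
coeff-dropLast (x ∷ []) zero (s≤s ())
coeff-dropLast (x ∷ y ∷ l) zero lt = refl
coeff-dropLast (x ∷ y ∷ l) (suc j) (s≤s lt) = coeff-dropLast (y ∷ l) j lt

length-dropLast : ∀ l → length (dropLast l) ≡ length l ∸ 1
length-dropLast [] = refl
length-dropLast (x ∷ []) = refl
length-dropLast (x ∷ y ∷ l) = cong suc (length-dropLast (y ∷ l))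

module Window (s : List ℤ) (e : ℕ) (len : length s ≡ suc e) where
  W : ℕ → ℕ → ℤ
  W n j = coeff (window s n) j

  length-window : ∀ n → length (window s n) ≡ suc e
  length-window zero = cong suc (trans (LP.length-replicate (length s ∸ 1)) (cong (_∸ 1) len))
  length-window (suc n) = cong suc
      (trans (length-dropLast (window s n)) (cong (_∸ 1) (length-window n)))

  W-step : ∀ n j → suc j ≤ e → W (suc n) (suc j) ≡ W n j
  W-step n j le = coeff-dropLast (window s n) j (subst (suc j <_) (sym (length-window n)) (s≤s le))

  W-shift : ∀ n j t → j ℕ.+ t ≤ e → W (n ℕ.+ t) (j ℕ.+ t) ≡ W n j
  W-shift n j zero le = cong₂ W (ℕP.+-identityʳ n) (ℕP.+-identityʳ j)
  W-shift n j (suc t) le = trans (cong₂ W (ℕP.+-suc n t) (ℕP.+-suc j t))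
      (trans (W-step (n ℕ.+ t) (j ℕ.+ t) (subst (_≤ e) (ℕP.+-suc j t) le))
        (W-shift n j t
          (ℕP.≤-trans (ℕP.m≤m+n (j ℕ.+ t) 1)
            (subst (_≤ e) (trans (ℕP.+-suc j t) (sym (ℕP.+-comm (j ℕ.+ t) 1))) le))))

  -- The last entry of the window: y n = h (n − e), the recurrence sequence h preceded by its
  -- e zero initial values.
  y : Seq
  y n = W n e

  W≡y : ∀ n j → j ≤ e → W n j ≡ y (n ℕ.+ (e ∸ j))
  W≡y n j le = sym
      (trans (cong (W (n ℕ.+ (e ∸ j))) (sym (ℕP.m+[n∸m]≡n le)))
        (W-shift n j (e ∸ j) (ℕP.≤-reflexive (ℕP.m+[n∸m]≡n le))))

  lrs≡y : ∀ n → lrs s n ≡ y (n ℕ.+ e)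
  lrs≡y n = trans (lemma (window s n)) (W≡y n 0 z≤n)
    where lemma : ∀ w → headOr0 w ≡ coeff w 0
          lemma [] = refl
          lemma (x ∷ w) = refl

  W-0 : ∀ j → 1 ≤ j → W 0 j ≡ + 0
  W-0 (suc j) _ = lemma (length s ∸ 1) j
    where lemma : ∀ k j → coeff (replicate k (+ 0)) j ≡ + 0
          lemma zero j = refl
          lemma (suc k) zero = refl
          lemma (suc k) (suc j) = lemma k j

  y-initial : ∀ i → i < e → y i ≡ + 0
  y-initial i lt = trans (sym (trans (cong₂ W (ℕP.+-identityˡ i) (ℕP.m∸n+n≡m (ℕP.<⇒≤ lt))) refl))
      (trans (W-shift 0 (e ∸ i) i (ℕP.≤-reflexive (ℕP.m∸n+n≡m (ℕP.<⇒≤ lt))))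
        (W-0 (e ∸ i) (ℕP.m<n⇒0<n∸m lt)))

  y-e≡1 : y e ≡ + 1
  y-e≡1 = W-shift 0 0 e ℕP.≤-refl

  y-recurrence : ∀ n → y (n ℕ.+ suc e) ≡ dot s (window s n)
  y-recurrence n = trans (cong y (trans (ℕP.+-suc n e) refl))
      (trans (sym (trans (W≡y (suc n) 0 z≤n) refl)) refl)

  monicPoly-annihilates-y : ∀ n → act (monicPoly s) y n ≡ + 0
  monicPoly-annihilates-y n = begin
      act (reverse (map -_ s) ++ [ + 1 ]) y n
    ≡⟨ act-++ (reverse (map -_ s)) [ + 1 ] y n ⟩
      act (reverse (map -_ s)) y n + (+ 1 * y (n ℕ.+ length (reverse (map -_ s))) + + 0)
    ≡⟨ cong₂ _+_
        (act-rev y (map -_ s) (window s n) n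
          (trans (length-window n) (sym (trans (LP.length-map -_ s) len))) hyp)
        (trans (ZP.+-identityʳ _)
          (trans (ZP.*-identityˡ _)
            (cong y
              (cong (n ℕ.+_) (trans (LP.length-reverse (map -_ s)) (trans (LP.length-map -_ s) len)))
                ))) ⟩
      dot (map -_ s) (window s n) + y (n ℕ.+ suc e)
    ≡⟨ cong₂ _+_ (dot-neg s (window s n)) (y-recurrence n) ⟩
      - dot s (window s n) + dot s (window s n)
    ≡⟨ ZP.+-inverseˡ (dot s (window s n)) ⟩
      + 0 ∎
    where
      hyp :
          ∀ j → j < length (map -_ s) → coeff (window s n) j ≡ y (n ℕ.+ (length (map -_ s) ∸ suc j))
      hyp j lt = trans (W≡y n j (ℕP.≤-pred (subst (suc j ≤_) (trans (LP.length-map -_ s) len) lt)))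
          (cong (λ k → y (n ℕ.+ (k ∸ suc j))) (sym (trans (LP.length-map -_ s) len)))

module Modulo (p : ℕ) (pp : Prime p) where
  -- Arithmetic in 𝔽ₚ and 𝔽ₚ[X]

  -- A record rather than a synonym for _≡_[mod_], so that both sides can be inferred.
  infix 4 _≈_
  record _≈_ (a b : ℤ) : Set where
    constructor mk≈
    field un≈ : a ≡ b [mod p ]
  open _≈_ public

  Vanishes : ℤ → Set
  Vanishes a = (+ p) SD.∣ a

  ≈⇒Vanishes : ∀ {a b} → a ≈ b → Vanishes (a - b)
  ≈⇒Vanishes {a} {b} e = ∣ᵤ⇒∣ {+ p} {a - b} (un≈ e)

  Vanishes⇒≈ : ∀ a b → Vanishes (a - b) → a ≈ b
  Vanishes⇒≈ a b z = mk≈ (∣⇒∣ᵤ {+ p} {a - b} z)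

  Vanishes-resp : ∀ {a b} → a ≡ b → Vanishes a → Vanishes b
  Vanishes-resp refl z = z

  Vanishes-0 : Vanishes (+ 0)
  Vanishes-0 = divides (+ 0) refl

  Vanishes-+ : ∀ {a b} → Vanishes a → Vanishes b → Vanishes (a + b)
  Vanishes-+ = SD.∣m∣n⇒∣m+n

  Vanishes-neg : ∀ {a} → Vanishes a → Vanishes (- a)
  Vanishes-neg = SD.∣m⇒∣-m

  Vanishes-*ˡ : ∀ a {b} → Vanishes b → Vanishes (a * b)
  Vanishes-*ˡ a = SD.∣n⇒∣m*n a

  Vanishes-*ʳ : ∀ {a} b → Vanishes a → Vanishes (a * b)
  Vanishes-*ʳ b = SD.∣m⇒∣m*n b

  ≈-refl : ∀ {a} → a ≈ a
  ≈-refl {a} = Vanishes⇒≈ a a (Vanishes-resp (sym (ZP.+-inverseʳ a)) Vanishes-0)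

  ≈-reflexive : ∀ {a b} → a ≡ b → a ≈ b
  ≈-reflexive refl = ≈-refl

  ≈-sym : ∀ {a b} → a ≈ b → b ≈ a
  ≈-sym {a} {b} e = Vanishes⇒≈ b a (Vanishes-resp (l a b) (Vanishes-neg (≈⇒Vanishes {a} {b} e)))
    where l : ∀ a b → - (a - b) ≡ b - a
          l = solve-∀

  ≈-trans : ∀ {a b c} → a ≈ b → b ≈ c → a ≈ c
  ≈-trans {a} {b} {c} e f = Vanishes⇒≈ a c
      (Vanishes-resp (l a b c) (Vanishes-+ (≈⇒Vanishes {a} {b} e) (≈⇒Vanishes {b} {c} f)))
    where l : ∀ a b c → (a - b) + (b - c) ≡ a - c
          l = solve-∀

  +-cong : ∀ {a b c d} → a ≈ b → c ≈ d → a + c ≈ b + d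
  +-cong {a} {b} {c} {d} e f = Vanishes⇒≈ (a + c) (b + d)
      (Vanishes-resp (l a b c d) (Vanishes-+ (≈⇒Vanishes {a} {b} e) (≈⇒Vanishes {c} {d} f)))
    where l : ∀ a b c d → (a - b) + (c - d) ≡ (a + c) - (b + d)
          l = solve-∀

  neg-cong : ∀ {a b} → a ≈ b → - a ≈ - b
  neg-cong {a} {b} e = Vanishes⇒≈ (- a) (- b)
      (Vanishes-resp (l a b) (Vanishes-neg (≈⇒Vanishes {a} {b} e)))
    where l : ∀ a b → - (a - b) ≡ (- a) - (- b)
          l = solve-∀

  *-cong : ∀ {a b c d} → a ≈ b → c ≈ d → a * c ≈ b * d
  *-cong {a} {b} {c} {d} e f = Vanishes⇒≈ (a * c) (b * d)
      (Vanishes-resp (l a b c d)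
        (Vanishes-+ (Vanishes-*ʳ c (≈⇒Vanishes {a} {b} e)) (Vanishes-*ˡ b (≈⇒Vanishes {c} {d} f))))
    where l : ∀ a b c d → (a - b) * c + b * (c - d) ≡ a * c - b * d
          l = solve-∀

  Vanishes⇒≈0 : ∀ {a} → Vanishes a → a ≈ + 0
  Vanishes⇒≈0 {a} z = Vanishes⇒≈ a (+ 0) (Vanishes-resp (sym (ZP.+-identityʳ a)) z)

  ≈0⇒Vanishes : ∀ {a} → a ≈ + 0 → Vanishes a
  ≈0⇒Vanishes {a} e = Vanishes-resp (ZP.+-identityʳ a) (≈⇒Vanishes {a} {+ 0} e)

  p≥2 : 2 ℕ.≤ p
  p≥2 = prime⇒2≤ pp

  1≉0 : ¬ (+ 1 ≈ + 0)
  1≉0 e with ∣⇒∣ᵤ {+ p} {+ 1} (≈0⇒Vanishes e)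
  ... | d = ℕP.<⇒≱ p≥2 (ND.∣⇒≤ d)

  ≈0? : ∀ a → Dec (a ≈ + 0)
  ≈0? a with p ND.∣? ∣ a ∣
  ... | yes d = yes (Vanishes⇒≈0 (∣ᵤ⇒∣ {+ p} {a} d))
  ... | no nd = no (λ e → nd (∣⇒∣ᵤ {+ p} {a} (≈0⇒Vanishes e)))

  ≈0-integral : ∀ a b → a * b ≈ + 0 → a ≈ + 0 ⊎ b ≈ + 0
  ≈0-integral a b e with euclidsLemma ∣ a ∣ ∣ b ∣ pp
      (subst (p ND.∣_) (ZP.abs-* a b) (∣⇒∣ᵤ {+ p} {a * b} (≈0⇒Vanishes e)))
  ... | inj₁ d = inj₁ (Vanishes⇒≈0 (∣ᵤ⇒∣ {+ p} {a} d))
  ... | inj₂ d = inj₂ (Vanishes⇒≈0 (∣ᵤ⇒∣ {+ p} {b} d))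

  *-cancelˡ-≈ : ∀ {a x y} → ¬ (a ≈ + 0) → a * x ≈ a * y → x ≈ y
  *-cancelˡ-≈ {a} {x} {y} a≉0 ax≈ay =
    [ (λ a≈0 → ⊥-elim (a≉0 a≈0)) , (λ x-y≈0 → Vanishes⇒≈ x y (≈0⇒Vanishes x-y≈0)) ]′
      (≈0-integral a (x - y) a[x-y]≈0)
    where
      factor : ∀ a x y → a * x - a * y ≡ a * (x - y)
      factor = solve-∀
      a[x-y]≈0 : a * (x - y) ≈ + 0
      a[x-y]≈0 = Vanishes⇒≈0 (Vanishes-resp (factor a x y) (≈⇒Vanishes {a * x} {a * y} ax≈ay))

  p∤⇒coprime : ∀ m → ¬ (p ND.∣ m) → Coprime p m
  p∤⇒coprime m nd (d∣p , d∣m) with prime⇒irreducible pp d∣p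
  ... | inj₁ eq = eq
  ... | inj₂ refl = ⊥-elim (nd d∣m)

  pos-Bézout : ∀ y m x q → 1 ℕ.+ y ℕ.* m ≡ x ℕ.* q → + 1 + + y * + m ≡ + x * + q
  pos-Bézout y m x q eq = trans
      (sym (trans (ZP.pos-+ 1 (y ℕ.* m)) (cong (λ w → + 1 + w) (ZP.pos-* y m))))
      (trans (cong +_ eq) (ZP.pos-* x q))

  inverseℕ : ∀ m → ¬ (p ND.∣ m) → Σ ℤ λ b → (+ m) * b ≈ + 1
  inverseℕ m nd with coprime-Bézout (p∤⇒coprime m nd)
  ... | Bézout.+- x y eq = - (+ y) , Vanishes⇒≈ ((+ m) * (- (+ y))) (+ 1) (divides (- (+ x)) e)
    where
      e : (+ m) * (- (+ y)) - + 1 ≡ - (+ x) * + p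
      e = begin
          (+ m) * (- (+ y)) - + 1 ≡⟨ l (+ m) (+ y) ⟩
          - (+ 1 + (+ y) * (+ m)) ≡⟨ cong -_ (pos-Bézout y m x p eq) ⟩
          - (+ x * + p) ≡⟨ ZP.neg-distribˡ-* (+ x) (+ p) ⟩
          - (+ x) * + p ∎
        where
          l : ∀ m y → m * (- y) - + 1 ≡ - (+ 1 + y * m)
          l = solve-∀
  ... | Bézout.-+ x y eq = + y , Vanishes⇒≈ ((+ m) * (+ y)) (+ 1) (divides (+ x) e)
    where
      e : (+ m) * (+ y) - + 1 ≡ + x * + p
      e = begin
          (+ m) * (+ y) - + 1 ≡⟨ cong (λ z → z - + 1) (ZP.*-comm (+ m) (+ y)) ⟩
          (+ y * + m) - + 1 ≡⟨ sym (cong (λ z → z - + 1) (pos-Bézout x p y m eq)) ⟩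
          ((+ 1 + (+ x) * (+ p)) - + 1) ≡⟨ l2 (+ x * + p) ⟩
          + x * + p ∎
        where
          l2 : ∀ w → (+ 1 + w) - + 1 ≡ w
          l2 = solve-∀

  inverse : ∀ a → ¬ (a ≈ + 0) → Σ ℤ λ b → a * b ≈ + 1
  inverse (+ m) na = inverseℕ m (λ d → na (Vanishes⇒≈0 {+ m} (∣ᵤ⇒∣ {+ p} {+ m} d)))
  inverse -[1+ m ] na with inverseℕ (suc m)
      (λ d → na (Vanishes⇒≈0 { -[1+ m ] } (∣ᵤ⇒∣ {+ p} { -[1+ m ] } d)))
  ... | b , e = - b , ≈-trans (≈-reflexive (l (+ suc m) b)) e
    where l : ∀ x b → (- x) * (- b) ≡ x * b
          l = solve-∀

  infix 4 _≋_
  record _≋_ (f g : Poly) : Set where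
    constructor mk≋
    field at≋ : ∀ i → coeff f i ≈ coeff g i
  open _≋_ public

  ≋⇒PolyEq : ∀ {f g} → f ≋ g → PolyEq p f g
  ≋⇒PolyEq e i = un≈ (at≋ e i)

  PolyEq⇒≋ : ∀ {f g} → PolyEq p f g → f ≋ g
  PolyEq⇒≋ e = mk≋ λ i → mk≈ (e i)

  ≐⇒≋ : ∀ {f g} → f ≐ g → f ≋ g
  ≐⇒≋ e = mk≋ λ i → ≈-reflexive (at≐ e i)

  ≋-refl : ∀ {f} → f ≋ f
  ≋-refl = mk≋ λ i → ≈-refl
  ≋-sym : ∀ {f g} → f ≋ g → g ≋ f
  ≋-sym e = mk≋ λ i → ≈-sym (at≋ e i)
  ≋-trans : ∀ {f g h} → f ≋ g → g ≋ h → f ≋ h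
  ≋-trans e e' = mk≋ λ i → ≈-trans (at≋ e i) (at≋ e' i)

  ≋-isEquivalence : IsEquivalence _≋_
  ≋-isEquivalence = record { refl = ≋-refl ; sym = ≋-sym ; trans = ≋-trans }

  ⊕-cong≋ : ∀ {f f' g g'} → f ≋ f' → g ≋ g' → f ⊕ g ≋ f' ⊕ g'
  ⊕-cong≋ {f} {f'} {g} {g'} e e' = mk≋ λ i → ≈-trans (≈-reflexive (coeff-⊕ f g i))
      (≈-trans (+-cong (at≋ e i) (at≋ e' i)) (≈-reflexive (sym (coeff-⊕ f' g' i))))

  neg-cong≋ : ∀ {f g} → f ≋ g → neg f ≋ neg g
  neg-cong≋ {f} {g} e = mk≋ λ i → ≈-trans (≈-reflexive (coeff-neg f i))
      (≈-trans (neg-cong (at≋ e i)) (≈-reflexive (sym (coeff-neg g i))))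

  scale-cong≋ : ∀ {a b f g} → a ≈ b → f ≋ g → scale a f ≋ scale b g
  scale-cong≋ {a} {b} {f} {g} ab e = mk≋ λ i → ≈-trans (≈-reflexive (coeff-scale a f i))
      (≈-trans (*-cong ab (at≋ e i)) (≈-reflexive (sym (coeff-scale b g i))))

  ∷-cong≋ : ∀ {a b f g} → a ≈ b → f ≋ g → (a ∷ f) ≋ (b ∷ g)
  ∷-cong≋ e e' = mk≋ λ { zero → e ; (suc i) → at≋ e' i }

  tail≋ : ∀ {a b f g} → (a ∷ f) ≋ (b ∷ g) → f ≋ g
  tail≋ e = mk≋ λ j → at≋ e (suc j)

  ⊗-zero≋ : ∀ {f} g → f ≋ [] → f ⊗ g ≋ []
  ⊗-zero≋ {[]} g e = ≋-refl
  ⊗-zero≋ {b ∷ f'} g e = mk≋ λ i → ≈-trans (≈-reflexive (coeff-⊗ b f' g i))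
      (≈-trans
        (+-cong (≈-trans (*-cong (at≋ e 0) ≈-refl) (≈-reflexive (ZP.*-zeroˡ (coeff g i)))) (l i))
        (≈-reflexive (ZP.+-identityˡ _)))
    where
      ih : f' ⊗ g ≋ []
      ih = ⊗-zero≋ {f'} g (mk≋ λ j → at≋ e (suc j))
      l : ∀ i → coeff (+ 0 ∷ (f' ⊗ g)) i ≈ + 0
      l zero = ≈-refl
      l (suc i) = at≋ ih i

  ⊗-congˡ≋ : ∀ {f f'} g → f ≋ f' → f ⊗ g ≋ f' ⊗ g
  ⊗-congˡ≋ {[]} {f'} g e = ≋-sym (⊗-zero≋ g (≋-sym e))
  ⊗-congˡ≋ {a ∷ f} {[]} g e = ⊗-zero≋ g e
  ⊗-congˡ≋ {a ∷ f} {b ∷ f'} g e = mk≋ λ i → ≈-trans (≈-reflexive (coeff-⊗ a f g i))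
      (≈-trans (+-cong (*-cong (at≋ e 0) ≈-refl) (at≋ (∷-cong≋ ≈-refl (⊗-congˡ≋ g (tail≋ e))) i))
        (≈-reflexive (sym (coeff-⊗ b f' g i))))

  ⊗-cong≋ : ∀ {f f' g g'} → f ≋ f' → g ≋ g' → f ⊗ g ≋ f' ⊗ g'
  ⊗-cong≋ {f} {f'} {g} {g'} e e' = ≋-trans (⊗-congˡ≋ g e)
      (≋-trans (≐⇒≋ (⊗-comm≐ f' g)) (≋-trans (⊗-congˡ≋ f' e') (≐⇒≋ (⊗-comm≐ g' f'))))

  ≋-isCommutativeRing : IsCommutativeRing _≋_ _⊕_ _⊗_ neg [] one
  ≋-isCommutativeRing = record
    { isRing = record
      { +-isAbelianGroup = record
        { isGroup = record
          { isMonoid = record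
            { isSemigroup = record
              { isMagma = record { isEquivalence = ≋-isEquivalence ; ∙-cong = ⊕-cong≋ }
              ; assoc = λ f g h → ≐⇒≋ (⊕-assoc≐ f g h) }
            ; identity = (λ f → ≐⇒≋ (⊕-idˡ≐ f)) , (λ f → ≐⇒≋ (⊕-idʳ≐ f)) }
          ; inverse = (λ f → ≐⇒≋ (⊕-invˡ≐ f)) , (λ f → ≐⇒≋ (⊕-invʳ≐ f))
          ; ⁻¹-cong = neg-cong≋ }
        ; comm = λ f g → ≐⇒≋ (⊕-comm≐ f g) }
      ; *-cong = ⊗-cong≋
      ; *-assoc = λ f g h → ≐⇒≋ (⊗-assoc≐ f g h)
      ; *-identity = (λ f → ≐⇒≋ (⊗-idˡ≐ f)) , (λ f → ≐⇒≋ (≐-trans (⊗-comm≐ f one) (⊗-idˡ≐ f)))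
      ; distrib = (λ f g h → ≐⇒≋ (⊗-distribˡ≐ f g h)) , (λ f g h → ≐⇒≋ (⊗-distribʳ≐ g h f))
      }
    ; *-comm = λ f g → ≐⇒≋ (⊗-comm≐ f g)
    }

  polyRing : CommutativeRing Level.zero Level.zero
  polyRing = record { isCommutativeRing = ≋-isCommutativeRing }

  act-≋0 : ∀ {f} x n → f ≋ [] → act f x n ≈ + 0
  act-≋0 {[]} x n e = ≈-refl
  act-≋0 {a ∷ f} x n e = ≈-trans
      (+-cong (*-cong (at≋ e 0) ≈-refl) (act-≋0 {f} x (suc n) (mk≋ λ j → at≋ e (suc j))))
      (≈-reflexive (l (x n)))
    where l : ∀ y → + 0 * y + + 0 ≡ + 0
          l = solve-∀

  ⊝≋0 : ∀ {f g} → f ≋ g → f ⊝ g ≋ []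
  ⊝≋0 {f} {g} e = ≋-trans (⊕-cong≋ e ≋-refl) (≐⇒≋ (⊕-invʳ≐ g))

  act-≋ : ∀ {f g} x n → f ≋ g → act f x n ≈ act g x n
  act-≋ {f} {g} x n e = Vanishes⇒≈ (act f x n) (act g x n)
      (Vanishes-resp (trans (act-⊕ f (neg g) x n) (cong (_+_ (act f x n)) (act-neg g x n)))
        (≈0⇒Vanishes (act-≋0 {f ⊝ g} x n (⊝≋0 e))))

  act-congʳ : ∀ f {x y} n → (∀ m → n ≤ m → x m ≈ y m) → act f x n ≈ act f y n
  act-congʳ [] n h = ≈-refl
  act-congʳ (a ∷ f) n h = +-cong (*-cong (≈-refl {a}) (h n ℕP.≤-refl))
      (act-congʳ f (suc n) (λ m le → h m (ℕP.≤-trans (ℕP.n≤1+n n) le)))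

  record DegBelow (f : Poly) (n : ℕ) : Set where
    constructor mkDegBelow
    field vanishes : ∀ i → n ≤ i → coeff f i ≈ + 0
  open DegBelow public

  coeff-≥length : ∀ f i → length f ≤ i → coeff f i ≡ + 0
  coeff-≥length [] i le = refl
  coeff-≥length (a ∷ f) (suc i) (s≤s le) = coeff-≥length f i le

  DegBelow-length : ∀ f → DegBelow f (length f)
  DegBelow-length f = mkDegBelow λ i le → ≈-reflexive (coeff-≥length f i le)

  DegBelow-≋ : ∀ {f g n} → f ≋ g → DegBelow f n → DegBelow g n
  DegBelow-≋ e b = mkDegBelow λ i le → ≈-trans (≈-sym (at≋ e i)) (vanishes b i le)

  DegBelow-mono : ∀ {f n m} → n ≤ m → DegBelow f n → DegBelow f m
  DegBelow-mono le b = mkDegBelow λ i le' → vanishes b i (ℕP.≤-trans le le')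

  DegBelow-0 : ∀ {f} → DegBelow f 0 → f ≋ []
  DegBelow-0 b = mk≋ λ i → vanishes b i z≤n

  ≋[]⇒DegBelow : ∀ {f} n → f ≋ [] → DegBelow f n
  ≋[]⇒DegBelow n e = mkDegBelow λ i _ → at≋ e i

  DegBelow-tail : ∀ {a f n} → DegBelow (a ∷ f) (suc n) → DegBelow f n
  DegBelow-tail b = mkDegBelow λ i le → vanishes b (suc i) (s≤s le)

  DegBelow-scale : ∀ {f n} a → DegBelow f n → DegBelow (scale a f) n
  DegBelow-scale {f} a bf = mkDegBelow λ i le → ≈-trans (≈-reflexive (coeff-scale a f i))
      (≈-trans (*-cong (≈-refl {a}) (vanishes bf i le)) (≈-reflexive (ZP.*-zeroʳ a)))

  ⊗-leading : ∀ f a → DegBelow f (suc a) → ∀ g b → DegBelow g (suc b) →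
        DegBelow (f ⊗ g) (suc (a ℕ.+ b)) × coeff (f ⊗ g) (a ℕ.+ b) ≈ coeff f a * coeff g b
  ⊗-leading [] a bf g b bg = ≋[]⇒DegBelow _ ≋-refl , ≈-reflexive (sym (ZP.*-zeroˡ (coeff g b)))
  ⊗-leading (x ∷ u) zero bf g b bg = mkDegBelow bnd , top
    where
      u0 : u ≋ []
      u0 = DegBelow-0 (DegBelow-tail bf)
      ug : u ⊗ g ≋ []
      ug = ⊗-zero≋ g u0
      c0 : ∀ i → coeff (+ 0 ∷ (u ⊗ g)) i ≈ + 0
      c0 zero = ≈-refl
      c0 (suc i) = at≋ ug i
      bnd : ∀ i → suc b ≤ i → coeff ((x ∷ u) ⊗ g) i ≈ + 0
      bnd i le = ≈-trans (≈-reflexive (coeff-⊗ x u g i))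
          (≈-trans (+-cong (*-cong (≈-refl {x}) (vanishes bg i le)) (c0 i)) (≈-reflexive (l x)))
        where l : ∀ x → x * + 0 + + 0 ≡ + 0
              l = solve-∀
      top : coeff ((x ∷ u) ⊗ g) b ≈ x * coeff g b
      top = ≈-trans (≈-reflexive (coeff-⊗ x u g b))
          (≈-trans (+-cong (≈-refl {x * coeff g b}) (c0 b)) (≈-reflexive (ZP.+-identityʳ _)))
  ⊗-leading (x ∷ u) (suc a) bf g b bg = mkDegBelow bnd , top
    where
      ih : DegBelow (u ⊗ g) (suc (a ℕ.+ b)) × coeff (u ⊗ g) (a ℕ.+ b) ≈ coeff u a * coeff g b
      ih = ⊗-leading u a (DegBelow-tail bf) g b bg
      bnd : ∀ i → suc (suc a ℕ.+ b) ≤ i → coeff ((x ∷ u) ⊗ g) i ≈ + 0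
      bnd (suc i) (s≤s le) = ≈-trans (≈-reflexive (coeff-⊗ x u g (suc i)))
          (≈-trans
            (+-cong
              (*-cong (≈-refl {x})
                (vanishes bg (suc i) (s≤s (ℕP.≤-trans (ℕP.m≤n+m b a) (ℕP.≤-trans (ℕP.n≤1+n _) le))))
                  )
              (vanishes (proj₁ ih) i le)) (≈-reflexive (l x)))
        where l : ∀ x → x * + 0 + + 0 ≡ + 0
              l = solve-∀
      top : coeff ((x ∷ u) ⊗ g) (suc a ℕ.+ b) ≈ coeff u a * coeff g b
      top = ≈-trans (≈-reflexive (coeff-⊗ x u g (suc a ℕ.+ b)))
          (≈-trans
            (+-cong (*-cong (≈-refl {x}) (vanishes bg (suc a ℕ.+ b) (s≤s (ℕP.m≤n+m b a))))
              (proj₂ ih)) (≈-reflexive (l x _)))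
        where l : ∀ x y → x * + 0 + y ≡ y
              l = solve-∀

  infix 4 _∣P_
  infixr 4 _∣,_
  record _∣P_ (f g : Poly) : Set where
    constructor _∣,_
    field
      quo : Poly
      quoEq : f ⊗ quo ≋ g
  open _∣P_ public

  ∣P-refl : ∀ {f} → f ∣P f
  ∣P-refl {f} = one ∣, ≋-trans (≐⇒≋ (⊗-comm≐ f one)) (≐⇒≋ (⊗-idˡ≐ f))

  ∣P-resp : ∀ {f f' g g'} → f ≋ f' → g ≋ g' → f ∣P g → f' ∣P g'
  ∣P-resp e e' (q ∣, h) = q ∣, ≋-trans (⊗-cong≋ (≋-sym e) ≋-refl) (≋-trans h e')

  ∣P-trans : ∀ {f g h} → f ∣P g → g ∣P h → f ∣P h
  ∣P-trans {f} {g} {h} (q ∣, e) (q' ∣, e') = q ⊗ q' ∣, ≋-trans (≋-sym (≐⇒≋ (⊗-assoc≐ f q q')))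
      (≋-trans (⊗-cong≋ e ≋-refl) e')

  ∣P-mulʳ : ∀ {f g} h → f ∣P g → f ∣P g ⊗ h
  ∣P-mulʳ {f} {g} h (q ∣, e) = q ⊗ h ∣, ≋-trans (≋-sym (≐⇒≋ (⊗-assoc≐ f q h))) (⊗-cong≋ e ≋-refl)

  ∣P-m⊗n : ∀ f g → f ∣P f ⊗ g
  ∣P-m⊗n f g = g ∣, ≋-refl

  ∣P-⊕ : ∀ {f g h} → f ∣P g → f ∣P h → f ∣P g ⊕ h
  ∣P-⊕ {f} (q ∣, e) (q' ∣, e') = q ⊕ q' ∣, ≋-trans
      (≋-trans (≐⇒≋ (⊗-comm≐ f (q ⊕ q')))
        (≋-trans (≐⇒≋ (⊗-distribʳ≐ q q' f)) (⊕-cong≋ (≐⇒≋ (⊗-comm≐ q f)) (≐⇒≋ (⊗-comm≐ q' f)))))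
      (⊕-cong≋ e e')

  ∣P-⊗-congʳ : ∀ {f g} h → f ∣P g → f ⊗ h ∣P g ⊗ h
  ∣P-⊗-congʳ {f} {g} h (q ∣, e) = q ∣, ≋-trans (l f h q) (⊗-cong≋ e ≋-refl)
    where l : ∀ f h q → f ⊗ h ⊗ q ≋ f ⊗ q ⊗ h
          l f h q = ≐⇒≋
              (≐-trans (⊗-assoc≐ f h q)
                (≐-trans (⊗-congʳ≐ f (⊗-comm≐ h q)) (≐-sym (⊗-assoc≐ f q h))))

  MonicDivides⇒∣P : ∀ {g f} → MonicDivides p g f → monicPoly g ∣P monicPoly f
  MonicDivides⇒∣P (q , e) = q ∣, PolyEq⇒≋ e

  ∣P⇒MonicDivides : ∀ {g f} → monicPoly g ∣P monicPoly f → MonicDivides p g f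
  ∣P⇒MonicDivides (q ∣, e) = q , ≋⇒PolyEq e

  record MonicOfDegree (f : Poly) (d : ℕ) : Set where
    constructor mkMonic
    field
      degBelow : DegBelow f (suc d)
      leading≈1 : coeff f d ≈ + 1
  open MonicOfDegree public

  monicPoly-monic : ∀ s → MonicOfDegree (monicPoly s) (length s)
  monicPoly-monic s = mkMonic
      (subst (DegBelow (monicPoly s)) (length-monic s) (DegBelow-length (monicPoly s)))
      (≈-reflexive (lc-monic s))

  MonicOfDegree-≋ : ∀ {f g d} → f ≋ g → MonicOfDegree f d → MonicOfDegree g d
  MonicOfDegree-≋ e (mkMonic b l) = mkMonic (DegBelow-≋ e b) (≈-trans (≈-sym (at≋ e _)) l)

  division-step :
      ∀ {m d} → MonicOfDegree m d → ∀ n g → DegBelow g (suc n) → d ≤ n → DegBelow (g ⊕ neg (m ⊗ scale (coeff g n) (Xpow (n ∸ d)))) n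
  division-step {m} {d} md n g bg dn' = mkDegBelow λ i le → ≈-trans
      (≈-reflexive
        (trans (coeff-⊕ g (neg (m ⊗ t)) i) (cong (_+_ (coeff g i)) (coeff-neg (m ⊗ t) i))))
      (cases i le)
    where
      k : ℕ
      k = n ∸ d
      a : ℤ
      a = coeff g n
      t : Poly
      t = scale a (Xpow k)
      mt : m ⊗ t ≐ scale a (shift k m)
      mt = ≐-trans (⊗-comm≐ m t) (≐-trans (scale-⊗≐ a (Xpow k) m) (scale-cong≐ a (Xpow⊗≐ k m)))
      kle : ∀ i → n ≤ i → k ≤ i
      kle i le = ℕP.≤-trans (ℕP.m∸n≤m n d) le
      cmt : ∀ i → n ≤ i → coeff (m ⊗ t) i ≈ a * coeff m (i ∸ k)
      cmt i le = ≈-reflexive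
          (trans (at≐ mt i)
            (trans (coeff-scale a (shift k m) i) (cong (a *_) (coeff-shift k m i (kle i le)))))
      l0 : ∀ a → + 0 + - (a * + 0) ≡ + 0
      l0 = solve-∀
      l1 : ∀ a → a + - (a * + 1) ≡ + 0
      l1 = solve-∀
      lt' : ∀ i → n < i → suc d ≤ i ∸ k
      lt' i lt = subst (_≤ i ∸ k)
          (trans (ℕP.+-∸-assoc 1 (ℕP.m∸n≤m n d)) (cong suc (ℕP.m∸[m∸n]≡n dn'))) (ℕP.∸-monoˡ-≤ k lt)
      cases : ∀ i → n ≤ i → coeff g i + - coeff (m ⊗ t) i ≈ + 0
      cases i le with ℕP.m≤n⇒m<n∨m≡n le
      ... | inj₁ lt = ≈-trans
          (+-cong (vanishes bg i lt)
            (neg-cong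
              (≈-trans (cmt i le) (*-cong (≈-refl {a}) (vanishes (degBelow md) (i ∸ k) (lt' i lt))))
                ))
          (≈-reflexive (l0 a))
      ... | inj₂ refl = ≈-trans
          (+-cong (≈-refl {a})
            (neg-cong
              (≈-trans (cmt n le)
                (*-cong (≈-refl {a})
                  (≈-trans (≈-reflexive (cong (coeff m) (ℕP.m∸[m∸n]≡n dn'))) (leading≈1 md))))))
          (≈-reflexive (l1 a))

  DivisionResult : Poly → ℕ → Poly → Set
  DivisionResult m d g = Σ Poly λ q → Σ Poly λ r → DegBelow r d × g ≋ m ⊗ q ⊕ r

  division-absorb : ∀ m d g t → DivisionResult m d (g ⊕ neg (m ⊗ t)) → DivisionResult m d g
  division-absorb m d g t (q , r , br , e) = q ⊕ t , r , br , ≋-trans (≐⇒≋ (≐-sym (⊝⊕≐ g (m ⊗ t))))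
      (≋-trans (⊕-cong≋ e ≋-refl) (l2 m q t r))
    where
      l2 : ∀ m q t r → (m ⊗ q ⊕ r) ⊕ m ⊗ t ≋ m ⊗ (q ⊕ t) ⊕ r
      l2 m q t r = ≐⇒≋
          (≐-trans (⊕-assoc≐ (m ⊗ q) r (m ⊗ t))
            (≐-trans (⊕-cong≐ (≐-refl {m ⊗ q}) (⊕-comm≐ r (m ⊗ t)))
              (≐-trans (≐-sym (⊕-assoc≐ (m ⊗ q) (m ⊗ t) r))
                (⊕-cong≐ (≐-sym (⊗-distribˡ≐ m q t)) (≐-refl {r})))))

  divide : ∀ {m d} → MonicOfDegree m d → ∀ n g → DegBelow g n → DivisionResult m d g
  divide {m} {d} md zero g bg = [] , g , DegBelow-mono z≤n bg , ≐⇒≋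
      (≐-sym (⊕-cong≐ (⊗-zeroʳ≐ m) ≐-refl))
  divide {m} {d} md (suc n) g bg with suc n ℕP.≤? d
  ... | yes le = [] , g , DegBelow-mono le bg , ≐⇒≋ (≐-sym (⊕-cong≐ (⊗-zeroʳ≐ m) ≐-refl))
  ... | no dn = division-absorb m d g (scale (coeff g n) (Xpow (n ∸ d)))
      (divide md n _ (division-step md n g bg (ℕP.≤-pred (ℕP.≰⇒> dn))))

  +-cancelʳ-≈ : ∀ {a b x} → a + x ≈ b + x → a ≈ b
  +-cancelʳ-≈ {a} {b} {x} e = ≈-trans (≈-reflexive (sym (l a x)))
      (≈-trans (+-cong e (≈-refl { - x})) (≈-reflexive (l b x)))
    where l : ∀ a x → a + x + - x ≡ a
          l = solve-∀

  −≈0⇒≈ : ∀ {a b} → a + - b ≈ + 0 → a ≈ b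
  −≈0⇒≈ {a} {b} e = +-cancelʳ-≈ {a} {b} { - b} (≈-trans e (≈-reflexive (sym (ZP.+-inverseʳ b))))

  ≈⇒−≈0 : ∀ {a b} → a ≈ b → a + - b ≈ + 0
  ≈⇒−≈0 {a} {b} e = ≈-trans (+-cong e (≈-refl { - b})) (≈-reflexive (ZP.+-inverseʳ b))

  act-0 : ∀ f n → act f (λ _ → + 0) n ≈ + 0
  act-0 [] n = ≈-refl
  act-0 (a ∷ f) n = ≈-trans (+-cong (≈-reflexive (ZP.*-zeroʳ a)) (act-0 f (suc n))) (≈-refl {+ 0})

  act-lowestTerm :
      ∀ (x : Seq) r n j → DegBelow r (suc j) → (∀ i → i < j → x (n ℕ.+ i) ≡ + 0) → act r x n ≈ coeff r j * x (n ℕ.+ j)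
  act-lowestTerm x [] n j b h = ≈-reflexive (sym (ZP.*-zeroˡ (x (n ℕ.+ j))))
  act-lowestTerm x (a ∷ r) n zero b h = ≈-trans
      (+-cong (≈-reflexive (cong (a *_) (cong x (sym (ℕP.+-identityʳ n)))))
        (act-≋0 {r} x (suc n) (DegBelow-0 (DegBelow-tail b)))) (≈-reflexive (ZP.+-identityʳ _))
  act-lowestTerm x (a ∷ r) n (suc j) b h = ≈-trans
      (+-cong
        (≈-reflexive
          (trans (cong (a *_) (trans (cong x (sym (ℕP.+-identityʳ n))) (h 0 (s≤s z≤n))))
            (ZP.*-zeroʳ a)))
        (act-lowestTerm x r (suc n) j (DegBelow-tail b)
          (λ i lt → trans (cong x (sym (ℕP.+-suc n i))) (h (suc i) (s≤s lt)))))
      (≈-reflexive (trans (ZP.+-identityˡ _) (cong (λ k → coeff r j * x k) (sym (ℕP.+-suc n j)))))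

  ≈-stable : ∀ {a b} → ¬ ¬ (a ≈ b) → a ≈ b
  ≈-stable {a} {b} nn with ≈0? (a + - b)
  ... | yes z = −≈0⇒≈ z
  ... | no nz = ⊥-elim (nn (λ e → nz (≈⇒−≈0 e)))

  ≋-stable : ∀ {f g} → ¬ ¬ (f ≋ g) → f ≋ g
  ≋-stable nn = mk≋ λ i → ≈-stable (λ k → nn (λ e → k (at≋ e i)))

  MonicOfDegree-≉0 : ∀ {f d} → MonicOfDegree f d → ¬ (f ≋ [])
  MonicOfDegree-≉0 {f} {d} md e = 1≉0 (≈-trans (≈-sym (leading≈1 md)) (at≋ e d))

  monic⇒monicPoly : ∀ {f d} → MonicOfDegree f d → Σ (List ℤ) λ s → length s ≡ d × monicPoly s ≋ f
  monic⇒monicPoly {f} {d} md = recurrenceOf f d , length-recurrenceOf f d , mk≋ λ i → ≈-trans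
      (≈-reflexive (cong (λ z → coeff z i) (monicPoly-recurrenceOf f d))) (cmp i)
    where
      lt : length (trunc d f) ≡ d
      lt = length-trunc d f
      cmp : ∀ i → coeff (trunc d f ++ [ + 1 ]) i ≈ coeff f i
      cmp i with ℕP.<-cmp i d
      ... | tri< a _ _ = ≈-reflexive
          (trans (coeff-++ˡ (trunc d f) [ + 1 ] i (subst (i <_) (sym lt) a)) (coeff-trunc d f i a))
      ... | tri≈ _ refl _ = ≈-trans
          (≈-reflexive
            (trans
              (cong (coeff (trunc i f ++ [ + 1 ]))
                (trans (sym (ℕP.+-identityʳ i)) (cong (ℕ._+ 0) (sym lt))))
              (coeff-++ (trunc i f) [ + 1 ] 0))) (≈-sym (leading≈1 md))
      ... | tri> _ _ c = ≈-trans
          (≈-reflexive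
            (trans
              (cong (coeff (trunc d f ++ [ + 1 ]))
                (trans (sym (ℕP.m+[n∸m]≡n (ℕP.<⇒≤ c))) (cong (ℕ._+ (i ∸ d)) (sym lt))))
              (trans (coeff-++ (trunc d f) [ + 1 ] (i ∸ d)) (l (i ∸ d) (ℕP.m<n⇒0<n∸m c)))))
          (≈-sym (vanishes (degBelow md) i c))
        where l : ∀ k → 0 < k → coeff [ + 1 ] k ≡ + 0
              l (suc k) _ = refl

  exact-degree : ∀ f → ¬ (f ≋ []) → ¬ ¬ (Σ ℕ λ n → DegBelow f (suc n) × ¬ (coeff f n ≈ + 0))
  exact-degree f nz = least-witness (DegBelow f) (length f) (DegBelow-length f) >>= λ
    { (zero , b , _) → ⊥-elim (nz (DegBelow-0 b))
    ; (suc n , b , mn) → pure (n , b , λ c0 → mn n (ℕP.n<1+n n) (mkDegBelow λ i le → cases i le c0 b)) }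
    where
      cases : ∀ {n} i → n ≤ i → coeff f n ≈ + 0 → DegBelow f (suc n) → coeff f i ≈ + 0
      cases {n} i le c0 b with ℕP.m≤n⇒m<n∨m≡n le
      ... | inj₁ lt = vanishes b i lt
      ... | inj₂ refl = c0

  MonicOfDegree-⊗ :
      ∀ {f g a b} → MonicOfDegree f a → MonicOfDegree g b → MonicOfDegree (f ⊗ g) (a ℕ.+ b)
  MonicOfDegree-⊗ {f} {g} {a} {b} mf mg with ⊗-leading f a (degBelow mf) g b (degBelow mg)
  ... | bb , tt = mkMonic bb
      (≈-trans tt (≈-trans (*-cong (leading≈1 mf) (leading≈1 mg)) (≈-refl {+ 1})))

  MonicOfDegree-unique : ∀ {f a b} → MonicOfDegree f a → MonicOfDegree f b → a ≡ b
  MonicOfDegree-unique {f} {a} {b} ma mb with ℕP.<-cmp a b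
  ... | tri< lt _ _ = ⊥-elim (1≉0 (≈-trans (≈-sym (leading≈1 mb)) (vanishes (degBelow ma) b lt)))
  ... | tri≈ _ eq _ = eq
  ... | tri> _ _ gt = ⊥-elim (1≉0 (≈-trans (≈-sym (leading≈1 ma)) (vanishes (degBelow mb) a gt)))

  MonicOfDegree-0 : ∀ {f} → MonicOfDegree f 0 → f ≋ one
  MonicOfDegree-0 {f} md = mk≋ λ
      { zero → leading≈1 md ; (suc i) → vanishes (degBelow md) (suc i) (s≤s z≤n) }

  monic-quotient :
      ∀ {g f w a b} → MonicOfDegree g a → MonicOfDegree f b → f ≋ g ⊗ w → ¬ ¬ (a ≤ b × MonicOfDegree w (b ∸ a))
  monic-quotient {g} {f} {w} {a} {b} mg mf e = exact-degree w wnz >>= λ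
      { (n , bw , lc) → pure (fin n bw lc) }
    where
      wnz : ¬ (w ≋ [])
      wnz w0 = MonicOfDegree-≉0 mf
          (≋-trans e (≋-trans (⊗-cong≋ (≋-refl {g}) w0) (≐⇒≋ (⊗-zeroʳ≐ g))))
      fin : ∀ n → DegBelow w (suc n) → ¬ (coeff w n ≈ + 0) → a ≤ b × MonicOfDegree w (b ∸ a)
      fin n bw lc = a≤b , subst (MonicOfDegree w) n≡ (mkMonic bw lc1)
        where
          T : DegBelow (g ⊗ w) (suc (a ℕ.+ n)) × coeff (g ⊗ w) (a ℕ.+ n) ≈ coeff g a * coeff w n
          T = ⊗-leading g a (degBelow mg) w n bw
          top : coeff f (a ℕ.+ n) ≈ coeff w n
          top = ≈-trans (at≋ e (a ℕ.+ n))
              (≈-trans (proj₂ T)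
                (≈-trans (*-cong (leading≈1 mg) (≈-refl {coeff w n}))
                  (≈-reflexive (ZP.*-identityˡ _))))
          le1 : a ℕ.+ n ≤ b
          le1 with a ℕ.+ n ℕP.≤? b
          ... | yes le = le
          ... | no nle = ⊥-elim
              (lc (≈-trans (≈-sym top) (vanishes (degBelow mf) (a ℕ.+ n) (ℕP.≰⇒> nle))))
          le2 : b ≤ a ℕ.+ n
          le2 with b ℕP.≤? a ℕ.+ n
          ... | yes le = le
          ... | no nle = ⊥-elim
              (1≉0
                (≈-trans (≈-sym (leading≈1 mf))
                  (≈-trans (at≋ e b) (vanishes (proj₁ T) b (ℕP.≰⇒> nle)))))
          eqb : a ℕ.+ n ≡ b
          eqb = ℕP.≤-antisym le1 le2
          a≤b : a ≤ b
          a≤b = ℕP.≤-trans (ℕP.m≤m+n a n) le1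
          n≡ : n ≡ b ∸ a
          n≡ = sym (trans (cong (_∸ a) (sym eqb)) (ℕP.m+n∸m≡n a n))
          lc1 : coeff w n ≈ + 1
          lc1 = ≈-trans (≈-sym top) (≈-trans (≈-reflexive (cong (coeff f) eqb)) (leading≈1 mf))

  monic-cancelˡ : ∀ {g a u v} → MonicOfDegree g a → g ⊗ u ≋ g ⊗ v → u ≋ v
  monic-cancelˡ {g} {a} {u} {v} mg e = diffP
      (≋-stable λ k → exact-degree (u ⊕ neg v) k (λ { (n , bw , lc) → lc (top n bw) }))
    where
      gd : g ⊗ (u ⊕ neg v) ≋ []
      gd = ≋-trans (≐⇒≋ (⊗-distribˡ≐ g u (neg v)))
          (≋-trans (⊕-cong≋ (≋-refl {g ⊗ u}) (≐⇒≋ (⊗-neg≐ g v)))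
            (≋-trans (⊕-cong≋ e (≋-refl {neg (g ⊗ v)})) (≐⇒≋ (⊕-invʳ≐ (g ⊗ v)))))
      top : ∀ n → DegBelow (u ⊕ neg v) (suc n) → coeff (u ⊕ neg v) n ≈ + 0
      top n bw = ≈-trans
          (≈-sym
            (≈-trans (*-cong (leading≈1 mg) (≈-refl {coeff (u ⊕ neg v) n}))
              (≈-reflexive (ZP.*-identityˡ _))))
          (≈-trans (≈-sym (proj₂ (⊗-leading g a (degBelow mg) (u ⊕ neg v) n bw))) (at≋ gd (a ℕ.+ n)))
      diffP : u ⊕ neg v ≋ [] → u ≋ v
      diffP d = ≋-trans (≐⇒≋ (≐-sym (⊝⊕≐ u v))) (≋-trans (⊕-cong≋ d (≋-refl {v})) ≋-refl)

  InIdeal : Poly → Poly → Poly → Set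
  InIdeal g A h = Σ Poly λ u → Σ Poly λ v → h ≋ u ⊗ g ⊕ v ⊗ A

  InIdeal-≋ : ∀ {g A h h'} → h ≋ h' → InIdeal g A h → InIdeal g A h'
  InIdeal-≋ e (u , v , eq) = u , v , ≋-trans (≋-sym e) eq

  InIdeal-⊕ : ∀ {g A h h'} → InIdeal g A h → InIdeal g A h' → InIdeal g A (h ⊕ h')
  InIdeal-⊕ {g} {A} (u , v , e) (u' , v' , e') = u ⊕ u' , v ⊕ v' , ≋-trans (⊕-cong≋ e e')
      (≐⇒≋
        (≐-trans (⊕-interchange≐ (u ⊗ g) (v ⊗ A) (u' ⊗ g) (v' ⊗ A))
          (⊕-cong≐ (≐-sym (⊗-distribʳ≐ u u' g)) (≐-sym (⊗-distribʳ≐ v v' A)))))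

  InIdeal-neg : ∀ {g A h} → InIdeal g A h → InIdeal g A (neg h)
  InIdeal-neg {g} {A} (u , v , e) = neg u , neg v , ≋-trans (neg-cong≋ e)
      (≐⇒≋ (≐-trans (neg-⊕≐ (u ⊗ g) (v ⊗ A)) (⊕-cong≐ (≐-sym (neg-⊗≐ u g)) (≐-sym (neg-⊗≐ v A)))))

  InIdeal-⊗ : ∀ {g A h} w → InIdeal g A h → InIdeal g A (h ⊗ w)
  InIdeal-⊗ {g} {A} {h} w (u , v , e) = u ⊗ w , v ⊗ w , ≋-trans (⊗-cong≋ e (≋-refl {w}))
      (≐⇒≋ (≐-trans (⊗-distribʳ≐ (u ⊗ g) (v ⊗ A) w) (⊕-cong≐ (sw u g) (sw v A))))
    where sw : ∀ u g → u ⊗ g ⊗ w ≐ u ⊗ w ⊗ g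
          sw u g = ≐-trans (⊗-assoc≐ u g w)
              (≐-trans (⊗-congʳ≐ u (⊗-comm≐ g w)) (≐-sym (⊗-assoc≐ u w g)))

  InIdeal-scale : ∀ {g A h} a → InIdeal g A h → InIdeal g A (scale a h)
  InIdeal-scale {g} {A} {h} a (u , v , e) = scale a u , scale a v , ≋-trans
      (scale-cong≋ (≈-refl {a}) e)
      (≐⇒≋
        (≐-trans (scale-⊕≐ a (u ⊗ g) (v ⊗ A))
          (⊕-cong≐ (≐-sym (scale-⊗≐ a u g)) (≐-sym (scale-⊗≐ a v A)))))

  ∣P-mulˡ : ∀ {f g} w → f ∣P g → f ∣P w ⊗ g
  ∣P-mulˡ {f} {g} w d = ∣P-resp ≋-refl (≐⇒≋ (⊗-comm≐ g w)) (∣P-mulʳ w d)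

  one-∣P : ∀ A → one ∣P A
  one-∣P A = A ∣, ≐⇒≋ (⊗-idˡ≐ A)

  NonzeroInIdealBelow : Poly → Poly → ℕ → Set
  NonzeroInIdealBelow g A n = Σ Poly λ h → InIdeal g A h × DegBelow h n × ¬ (h ≋ [])

  remainder-InIdeal :
      ∀ {g A M' h q r} → InIdeal g A h → InIdeal g A M' → h ≋ M' ⊗ q ⊕ r → InIdeal g A r
  remainder-InIdeal {g} {A} {M'} {h} {q} {r} hI inM' eqh =
      InIdeal-≋
        (≋-trans (⊕-cong≋ eqh (≋-refl {neg (M' ⊗ q)}))
          (≐⇒≋ (≐-trans (⊕-cong≐ (⊕-comm≐ (M' ⊗ q) r) (≐-refl {neg (M' ⊗ q)})) (cancelR r (M' ⊗ q))))
            )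
        (InIdeal-⊕ hI (InIdeal-neg (InIdeal-⊗ q inM')))
    where cancelR : ∀ r w → (r ⊕ w) ⊕ neg w ≐ r
          cancelR r w = mk≐ λ i → trans (coeff-⊕ (r ⊕ w) (neg w) i)
              (trans (cong₂ _+_ (coeff-⊕ r w i) (coeff-neg w i)) (l (coeff r i) (coeff w i)))
            where l : ∀ a b → a + b + - b ≡ a
                  l = solve-∀

  remainder≋0⇒∣P : ∀ {M' h} q r → h ≋ M' ⊗ q ⊕ r → r ≋ [] → M' ∣P h
  remainder≋0⇒∣P {M'} {h} q r eqh r0 = q ∣, ≋-sym
      (≋-trans eqh (≋-trans (⊕-cong≋ (≋-refl {M' ⊗ q}) r0) (≐⇒≋ (⊕-idʳ≐ (M' ⊗ q)))))

  minimal-∣P-InIdeal :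
      ∀ {g A M' k} → MonicOfDegree M' k → (∀ r → InIdeal g A r → DegBelow r k → ¬ ¬ (r ≋ [])) → InIdeal g A M'
      → ∀ h → InIdeal g A h → M' ∣P h
  minimal-∣P-InIdeal {g} {A} {M'} {k} mM' minK inM' h hI with
      divide mM' (length h) h (DegBelow-length h)
  ... | q , r , br , eqh = remainder≋0⇒∣P q r eqh
      (≋-stable (minK r (remainder-InIdeal {g} {A} {M'} {h} {q} {r} hI inM' eqh) br))

  ∣P-⊗-unitIdeal : ∀ {g A B} → g ∣P A ⊗ B → InIdeal g A one → g ∣P B
  ∣P-⊗-unitIdeal {g} {A} {B} gAB (u , v , e) = ∣P-resp ≋-refl
      (≋-trans (⊗-cong≋ (≋-sym e) (≋-refl {B})) (≐⇒≋ (⊗-idˡ≐ B)))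
      (∣P-resp ≋-refl (≐⇒≋ (≐-sym (⊗-distribʳ≐ (u ⊗ g) (v ⊗ A) B)))
        (∣P-⊕ (∣P-resp ≋-refl (≐⇒≋ g⊗uB≐ugB) (∣P-m⊗n g (u ⊗ B)))
              (∣P-resp ≋-refl (≐⇒≋ (≐-sym (⊗-assoc≐ v A B))) (∣P-mulˡ v gAB))))
    where
      g⊗uB≐ugB : g ⊗ (u ⊗ B) ≐ u ⊗ g ⊗ B
      g⊗uB≐ugB = ≐-trans (⊗-comm≐ g (u ⊗ B))
        (≐-trans (⊗-assoc≐ u B g) (≐-trans (⊗-congʳ≐ u (⊗-comm≐ B g)) (≐-sym (⊗-assoc≐ u g B))))

  irreducible-no-proper-factorisation :
      ∀ sg → MonicIrreducible p sg → ∀ {M' w k j} → M' ⊗ w ≋ monicPoly sg →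
              (Σ (List ℤ) λ s → length s ≡ suc k × monicPoly s ≋ M') →
                (Σ (List ℤ) λ s → length s ≡ suc j × monicPoly s ≋ w) → ⊥
  irreducible-no-proper-factorisation sg irr ew (s1 , l1 , e1) (s2 , l2 , e2) =
      proj₂ irr s1 s2 (subst (1 ≤_) (sym l1) (s≤s z≤n)) (subst (1 ≤_) (sym l2) (s≤s z≤n))
        (≋⇒PolyEq (≋-trans (⊗-cong≋ e1 e2) ew))

  irreducible-prime-case-proper :
      ∀ sg → MonicIrreducible p sg → ∀ {M' w A B k} → MonicOfDegree M' (suc k) → M' ⊗ w ≋ monicPoly sg
      → M' ∣P A → ∀ j → MonicOfDegree w j → ¬ ¬ (monicPoly sg ∣P A ⊎ monicPoly sg ∣P B)
  irreducible-prime-case-proper sg irr {M'} {w} mM' ew MA zero mw =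
      pure
        (inj₁
          (∣P-trans
            (∣P-resp
              (≋-trans
                (≋-trans (≋-sym (≐⇒≋ (≐-trans (⊗-comm≐ M' one) (⊗-idˡ≐ M'))))
                  (⊗-cong≋ (≋-refl {M'}) (≋-sym (MonicOfDegree-0 mw)))) ew) ≋-refl ∣P-refl) MA))
  irreducible-prime-case-proper sg irr {M'} {w} mM' ew MA (suc j) mw =
      λ _ → irreducible-no-proper-factorisation sg irr ew (monic⇒monicPoly mM') (monic⇒monicPoly mw)

  irreducible-prime-case :
      ∀ sg → MonicIrreducible p sg → ∀ {A B M'} k → MonicOfDegree M' k → InIdeal (monicPoly sg) A M'
      → monicPoly sg ∣P A ⊗ B → M' ∣P monicPoly sg → M' ∣P A → ¬ ¬ (monicPoly sg ∣P A ⊎ monicPoly sg ∣P B)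
  irreducible-prime-case sg irr {A} {B} {M'} zero mM' inM' gAB Mg MA =
      pure (inj₂ (∣P-⊗-unitIdeal gAB (InIdeal-≋ (MonicOfDegree-0 mM') inM')))
  irreducible-prime-case sg irr {A} {B} {M'} (suc k) mM' inM' gAB (w ∣, ew) MA =
      monic-quotient mM' (monicPoly-monic sg) (≋-sym ew) >>= λ
        { (le , mw) → irreducible-prime-case-proper sg irr mM' ew MA _ mw }

  minimal-leading≉0 :
      ∀ {g A M k} → DegBelow M (suc k) → (∀ k' → k' < suc k → ¬ NonzeroInIdealBelow g A k') → InIdeal g A M
      → ¬ (M ≋ []) → ¬ (coeff M k ≈ + 0)
  minimal-leading≉0 {g} {A} {M} {k} bM mn inM nzM c0 = mn k (ℕP.n<1+n k) (M , inM , mkDegBelow bk , nzM)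
    where bk : ∀ i → k ≤ i → coeff M i ≈ + 0
          bk i le with ℕP.m≤n⇒m<n∨m≡n le
          ... | inj₁ lt = vanishes bM i lt
          ... | inj₂ refl = c0

  -- A nonzero element of least degree of the ideal (g, A), made monic, divides g and A; as g is
  -- irreducible it is either 1, and then g ∣ B, or an associate of g, and then g ∣ A.
  irreducible-prime-minimal :
      ∀ sg → MonicIrreducible p sg → ∀ A B → monicPoly sg ∣P A ⊗ B → Σ ℕ (Least (NonzeroInIdealBelow (monicPoly sg) A))
      → ¬ ¬ (monicPoly sg ∣P A ⊎ monicPoly sg ∣P B)
  irreducible-prime-minimal sg irr A B gAB (zero , (M , inM , bM , nzM) , mn) =
      ⊥-elim (nzM (DegBelow-0 bM))
  irreducible-prime-minimal sg irr A B gAB (suc k , (M , inM , bM , nzM) , mn) with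
      inverse (coeff M k) (minimal-leading≉0 bM mn inM nzM)
  ... | λ' , inv-e = irreducible-prime-case sg irr k mM' inM' gAB
      (minimal-∣P-InIdeal mM' minK inM' (monicPoly sg) gI) (minimal-∣P-InIdeal mM' minK inM' A AI)
    where
      g : Poly
      g = monicPoly sg
      gI : InIdeal g A g
      gI = one , [] , ≋-sym (≐⇒≋ (≐-trans (⊕-idʳ≐ (one ⊗ g)) (⊗-idˡ≐ g)))
      AI : InIdeal g A A
      AI = [] , one , ≋-sym (≐⇒≋ (⊗-idˡ≐ A))
      M' : Poly
      M' = scale λ' M
      mM' : MonicOfDegree M' k
      mM' = mkMonic (DegBelow-scale λ' bM)
          (≈-trans (≈-reflexive (trans (coeff-scale λ' M k) (ZP.*-comm λ' (coeff M k)))) inv-e)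
      inM' : InIdeal g A M'
      inM' = InIdeal-scale λ' inM
      minK : ∀ r → InIdeal g A r → DegBelow r k → ¬ ¬ (r ≋ [])
      minK r rI br nr = mn k (ℕP.n<1+n k) (r , rI , br , nr)

  irreducible-prime :
      ∀ sg → MonicIrreducible p sg → ∀ A B → monicPoly sg ∣P A ⊗ B → ¬ ¬ (monicPoly sg ∣P A ⊎ monicPoly sg ∣P B)
  irreducible-prime sg irr A B gAB = least-witness (NonzeroInIdealBelow g A) (suc (length sg))
      (g , gI , degBelow (monicPoly-monic sg) , MonicOfDegree-≉0 (monicPoly-monic sg)) >>=
      irreducible-prime-minimal sg irr A B gAB
    where
      g : Poly
      g = monicPoly sg
      gI : InIdeal g A g
      gI = one , [] , ≋-sym (≐⇒≋ (≐-trans (⊕-idʳ≐ (one ⊗ g)) (⊗-idˡ≐ g)))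

  HasIrreducibleFactor : Poly → Set
  HasIrreducibleFactor f = Σ (List ℤ) λ sg → MonicIrreducible p sg × monicPoly sg ∣P f

  proper-factor-shorter :
      ∀ a b {f d} → MonicOfDegree f d → monicPoly a ⊗ monicPoly b ≋ f → 1 ≤ length b → length a < d
  proper-factor-shorter a b {f} {d} md e lb = subst (length a <_)
      (MonicOfDegree-unique (MonicOfDegree-⊗ (monicPoly-monic a) (monicPoly-monic b))
        (MonicOfDegree-≋ (≋-sym e) md))
      (subst (ℕ._≤ length a ℕ.+ length b) (ℕP.+-comm (length a) 1) (ℕP.+-monoʳ-≤ (length a) lb))

  irreducible-factor-step :
      ∀ {f d} → MonicOfDegree f d →
      (∀ a → length a < d → 1 ≤ length a → ¬ ¬ HasIrreducibleFactor (monicPoly a)) →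
      (Σ (List ℤ) λ a → Σ (List ℤ) λ b → 1 ≤ length a × 1 ≤ length b ×
         PolyEq p (monicPoly a *ₚ monicPoly b) (monicPoly (recurrenceOf f d))) →
      ¬ ¬ HasIrreducibleFactor f
  irreducible-factor-step {f} {d} md rec (a , b , la , lb , pe) =
      rec a (proper-factor-shorter a b md e lb) la >>= λ
        { (sg , irr , dv) → pure (sg , irr , ∣P-trans dv (monicPoly b ∣, e)) }
    where e : monicPoly a ⊗ monicPoly b ≋ f
          e = ≋-trans (PolyEq⇒≋ pe) (proj₂ (proj₂ (monic⇒monicPoly md)))

  irreducible-factor : ∀ N {f d} → d ≤ N → MonicOfDegree f d → 1 ≤ d → ¬ ¬ HasIrreducibleFactor f
  irreducible-factor zero {f} {zero} le md ()
  irreducible-factor (suc N) {f} {d} le md ld = ¬¬-excluded-middle {A = MonicIrreducible p sf} >>= λ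
    { (yes irr) → pure (sf , irr , ∣P-resp (≋-sym ef) ≋-refl ∣P-refl)
    ; (no ni) → (λ k → ni (subst (1 ≤_) (sym lf) ld , λ a b la lb pe → k (a , b , la , lb , pe)))
        >>= irreducible-factor-step md
        (λ a lt la → irreducible-factor N (ℕP.≤-pred (ℕP.≤-trans lt le)) (monicPoly-monic a) la) }
    where
      sf : List ℤ
      sf = recurrenceOf f d
      lf : length sf ≡ d
      lf = proj₁ (proj₂ (monic⇒monicPoly md))
      ef : monicPoly sf ≋ f
      ef = proj₂ (proj₂ (monic⇒monicPoly md))

  monic∤constant : ∀ {g a} → MonicOfDegree g a → 1 ≤ a → ∀ q → ¬ (q ≈ + 0) → ¬ (g ∣P (q ∷ []))
  monic∤constant {g} {a} mg la q nq (w ∣, e) = exact-degree w wnz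
      (λ { (n , bw , lc) → lc (top n bw) })
    where
      wnz : ¬ (w ≋ [])
      wnz w0 = nq
          (≈-trans (≈-sym (at≋ e 0)) (at≋ (≋-trans (⊗-cong≋ (≋-refl {g}) w0) (≐⇒≋ (⊗-zeroʳ≐ g))) 0))
      hi' : ∀ a n → 1 ≤ a → coeff (q ∷ []) (a ℕ.+ n) ≡ + 0
      hi' (suc a') n _ = refl
      hi : ∀ n → coeff (q ∷ []) (a ℕ.+ n) ≡ + 0
      hi n = hi' a n la
      top : ∀ n → DegBelow w (suc n) → coeff w n ≈ + 0
      top n bw = ≈-trans
          (≈-sym
            (≈-trans (*-cong (leading≈1 mg) (≈-refl {coeff w n})) (≈-reflexive (ZP.*-identityˡ _))))
          (≈-trans (≈-sym (proj₂ (⊗-leading g a (degBelow mg) w n bw)))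
            (≈-trans (at≋ e (a ℕ.+ n)) (≈-reflexive (hi n))))

  NoCommonIrreducibleFactor : Poly → Poly → Set
  NoCommonIrreducibleFactor f Φ = ∀ sg → MonicIrreducible p sg → monicPoly sg ∣P f → ¬
      (monicPoly sg ∣P Φ)

  -- An irreducible factor g of f divides A · Φ but not Φ, hence A; cancel it and recurse.
  ∣P-cancel-step : ∀ {f d A Φ} → MonicOfDegree f d → f ∣P A ⊗ Φ → NoCommonIrreducibleFactor f Φ →
    (∀ {f' d' A'} → d' < d → MonicOfDegree f' d' → f' ∣P A' ⊗ Φ →
       NoCommonIrreducibleFactor f' Φ → ¬ ¬ (f' ∣P A')) →
    HasIrreducibleFactor f → ¬ ¬ (f ∣P A)
  ∣P-cancel-step {f} {d} {A} {Φ} mf (Q ∣, eQ) kh rec (sg , irr , (f' ∣, ef')) =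
      irreducible-prime sg irr A Φ (∣P-trans (f' ∣, ef') (Q ∣, eQ)) >>= λ
    { (inj₂ gΦ) → ⊥-elim (kh sg irr (f' ∣, ef') gΦ)
    ; (inj₁ (A' ∣, eA)) → monic-quotient (monicPoly-monic sg) mf (≋-sym ef') >>= λ { (le , mf') →
        rec {A' = A'} (ℕP.∸-monoʳ-< (proj₁ irr) le) mf'
          (Q ∣, monic-cancelˡ (monicPoly-monic sg) (c1 A' eA))
          (λ h hirr hf' → kh h hirr (∣P-trans hf' (g ∣, ≋-trans (≐⇒≋ (⊗-comm≐ f' g)) ef'))) >>= λ d' →
        pure (∣P-resp ef' eA (∣P-resp (≐⇒≋ (⊗-comm≐ f' g)) (≐⇒≋ (⊗-comm≐ A' g)) (∣P-⊗-congʳ g d'))) } }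
    where
      g : Poly
      g = monicPoly sg
      c1 : ∀ A' → g ⊗ A' ≋ A → g ⊗ (f' ⊗ Q) ≋ g ⊗ (A' ⊗ Φ)
      c1 A' eA = ≋-trans (≐⇒≋ (≐-sym (⊗-assoc≐ g f' Q)))
          (≋-trans (⊗-cong≋ ef' (≋-refl {Q}))
            (≋-trans eQ (≋-trans (⊗-cong≋ (≋-sym eA) (≋-refl {Φ})) (≐⇒≋ (⊗-assoc≐ g A' Φ)))))

  ∣P-cancel-coprime :
      ∀ N {f d A Φ} → d ≤ N → MonicOfDegree f d → f ∣P A ⊗ Φ → NoCommonIrreducibleFactor f Φ → ¬ ¬ (f ∣P A)
  ∣P-cancel-coprime N {f} {zero} {A} {Φ} le mf dv kh =
      pure (∣P-resp (≋-sym (MonicOfDegree-0 mf)) ≋-refl (one-∣P A))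
  ∣P-cancel-coprime zero {f} {suc d} () mf dv kh
  ∣P-cancel-coprime (suc N) {f} {suc d} {A} {Φ} le mf dv kh =
    irreducible-factor (suc d) ℕP.≤-refl mf (s≤s z≤n) >>= ∣P-cancel-step mf dv kh
      (λ d'<d → ∣P-cancel-coprime N (ℕP.≤-trans (ℕP.≤-pred d'<d) (ℕP.≤-pred le)))

  polyCommutativeSemiring : CommutativeSemiring Level.zero Level.zero
  polyCommutativeSemiring = CommutativeRing.commutativeSemiring polyRing
  polySemiring : Semiring Level.zero Level.zero
  polySemiring = CommutativeSemiring.semiring polyCommutativeSemiring
  module B = Bin polyCommutativeSemiring
  module E = Exp polySemiring
  module M = Mult polySemiring
  module S = Sum polySemiring

  infixr 8 _^P_
  _^P_ : Poly → ℕ → Poly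
  _^P_ = E._^_

  ×≋scale : ∀ n z → n M.× z ≋ scale (+ n) z
  ×≋scale zero z = mk≋ λ i → ≈-reflexive
      (sym (trans (coeff-scale (+ 0) z i) (ZP.*-zeroˡ (coeff z i))))
  ×≋scale (suc n) z = ≋-trans (⊕-cong≋ (≋-refl {z}) (×≋scale n z))
      (mk≋ λ i → ≈-reflexive
        (trans (coeff-⊕ z (scale (+ n) z) i)
          (trans (cong (_+_ (coeff z i)) (coeff-scale (+ n) z i))
            (trans (l (coeff z i) (+ n))
              (trans (cong (_* coeff z i) (sym (ZP.pos-+ 1 n))) (sym (coeff-scale (+ suc n) z i)))
                ))))
    where l : ∀ c n → c + n * c ≡ (+ 1 + n) * c
          l = solve-∀

  p∣n⇒n×≋[] : ∀ n z → p ND.∣ n → n M.× z ≋ []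
  p∣n⇒n×≋[] n z d = ≋-trans (×≋scale n z)
      (mk≋ λ i → ≈-trans (≈-reflexive (coeff-scale (+ n) z i))
        (Vanishes⇒≈0 (Vanishes-*ʳ (coeff z i) (∣ᵤ⇒∣ {+ p} {+ n} d))))

  sum-last : ∀ n (t : Fin (suc n) → Poly) → (∀ i → t (inject₁ i) ≋ []) → S.sum t ≋ t (fromℕ n)
  sum-last zero t h = ≐⇒≋ (⊕-idʳ≐ (t Fin.zero))
  sum-last (suc n) t h = ≋-trans
      (⊕-cong≋ (h Fin.zero) (sum-last n (λ i → t (Fin.suc i)) (λ i → h (Fin.suc i)))) ≋-refl

  binomialTerm≡ :
      ∀ x y n k j → toℕ k ≡ j → B.binomialTerm x y n k ≡ (n C j) M.× (x ^P j ⊗ y ^P (n ∸ j))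
  binomialTerm≡ x y n k j refl = refl

  ≡⇒≋ : ∀ {a b} → a ≡ b → a ≋ b
  ≡⇒≋ refl = ≋-refl

  1×≋ : ∀ z → 1 M.× z ≋ z
  1×≋ z = ≐⇒≋ (⊕-idʳ≐ z)

  frobenius-at : ∀ x y n → n ≡ p → (x ⊕ y) ^P n ≋ x ^P n ⊕ y ^P n
  frobenius-at x y zero eq = ⊥-elim (ℕP.<⇒≱ (p≥2) (ℕP.≤-trans (ℕP.≤-reflexive (sym eq)) z≤n))
  frobenius-at x y (suc r) eq = ≋-trans (B.theorem (suc r) x y)
      (≋-trans (⊕-cong≋ t0 (≋-trans (sum-last r (λ i → T (Fin.suc i)) mid) tl))
        (≐⇒≋ (⊕-comm≐ (y ^P suc r) (x ^P suc r))))
    where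
      T : Fin (suc (suc r)) → Poly
      T = B.binomialTerm x y (suc r)
      t0 : T Fin.zero ≋ y ^P suc r
      t0 = ≋-trans
          (≡⇒≋
            (cong (λ c → c M.× (one ⊗ y ^P suc r))
              (trans (nCk≡nC[n∸k] {0} {suc r} z≤n) (nCn≡1 (suc r)))))
          (≋-trans (1×≋ _) (≐⇒≋ (⊗-idˡ≐ (y ^P suc r))))
      tl : T (Fin.suc (fromℕ r)) ≋ x ^P suc r
      tl = ≋-trans
          (≡⇒≋
            (trans
              (binomialTerm≡ x y (suc r) (Fin.suc (fromℕ r)) (suc r) (cong suc (FP.toℕ-fromℕ r)))
              (cong (λ c → c M.× (x ^P suc r ⊗ y ^P (suc r ∸ suc r))) (nCn≡1 (suc r)))))
          (≋-trans (1×≋ _)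
            (≋-trans (⊗-cong≋ (≋-refl {x ^P suc r}) (≡⇒≋ (cong (y ^P_) (ℕP.n∸n≡0 r))))
              (≐⇒≋ (≐-trans (⊗-comm≐ (x ^P suc r) one) (⊗-idˡ≐ (x ^P suc r))))))
      mid : ∀ i → T (Fin.suc (inject₁ i)) ≋ []
      mid i = ≋-trans
          (≡⇒≋
            (binomialTerm≡ x y (suc r) (Fin.suc (inject₁ i)) (suc (toℕ i))
              (cong suc (FP.toℕ-inject₁ i))))
          (p∣n⇒n×≋[] _ _
            (subst (λ q → q ND.∣ (suc r C suc (toℕ i))) eq
              (subst (λ q → q ND.∣ (q C suc (toℕ i))) (sym eq)
                (p∣pCk p pp (suc (toℕ i)) (s≤s z≤n) (subst (suc (toℕ i) <_) eq (s≤s (FP.toℕ<n i))))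
                  )))

  frobenius : ∀ x y → (x ⊕ y) ^P p ≋ x ^P p ⊕ y ^P p
  frobenius x y = frobenius-at x y p refl

  -- Periods and the polynomials X^c − 1

  period-multiple≈ : ∀ (x : Seq) L → (∀ n → x (n ℕ.+ L) ≈ x n) → ∀ j n → x (n ℕ.+ j ℕ.* L) ≈ x n
  period-multiple≈ x L h zero n = ≈-reflexive (cong x (ℕP.+-identityʳ n))
  period-multiple≈ x L h (suc j) n = ≈-trans (≈-reflexive (cong x (l n L (j ℕ.* L))))
      (≈-trans (h (n ℕ.+ j ℕ.* L)) (period-multiple≈ x L h j n))
    where l : ∀ n L m → n ℕ.+ (L ℕ.+ m) ≡ n ℕ.+ m ℕ.+ L
          l n L m = trans (cong (n ℕ.+_) (ℕP.+-comm L m)) (sym (ℕP.+-assoc n m L))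

  shiftSum-periodic :
      ∀ (x : Seq) L → (∀ n → x (n ℕ.+ L) ≈ x n) → ∀ j n → shiftSum L j x n ≈ (+ j) * x n
  shiftSum-periodic x L h zero n = ≈-reflexive (sym (ZP.*-zeroˡ (x n)))
  shiftSum-periodic x L h (suc j) n = ≈-trans
      (+-cong (shiftSum-periodic x L h j n) (period-multiple≈ x L h j n))
      (≈-reflexive (trans (l (+ j) (x n)) (cong (_* x n) (sym (ZP.pos-+ 1 j)))))
    where l : ∀ a b → a * b + b ≡ (+ 1 + a) * b
          l = solve-∀

  IsPeriod-* : ∀ x L → IsPeriod p x L → ∀ j → IsPeriod p x (j ℕ.* L)
  IsPeriod-* x L h j n = un≈ (period-multiple≈ x L (λ m → mk≈ (h m)) j n)

  leastPeriod-∣-period : ∀ x π c → IsLeastPeriod p x π → IsPeriod p x c → π ND.∣ c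
  leastPeriod-∣-period x π c (π≥1 , perπ , least) perc = body {{ℕ.>-nonZero π≥1}}
    where
      body : {{_ : NonZero π}} → π ND.∣ c
      body with c % π ℕP.≟ 0
      ... | yes r0 = ND.divides (c / π) (trans (m≡m%n+[m/n]*n c π) (cong (ℕ._+ (c / π) ℕ.* π) r0))
      ... | no r≠0 = ⊥-elim (ℕP.<⇒≱ (m%n<n c π) (least (c % π) (ℕP.n≢0⇒n>0 r≠0) perR))
        where
          r : ℕ
          r = c % π
          q : ℕ
          q = c / π
          eqc : c ≡ r ℕ.+ q ℕ.* π
          eqc = m≡m%n+[m/n]*n c π
          perR : IsPeriod p x r
          perR n = un≈
              (≈-trans (≈-sym (mk≈ (IsPeriod-* x π perπ q (n ℕ.+ r))))
                (≈-trans
                  (≈-reflexive (cong x (trans (ℕP.+-assoc n r (q ℕ.* π)) (cong (n ℕ.+_) (sym eqc)))))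
                  (mk≈ (perc n))))

  ∣P-coeff₀≉0 : ∀ {g f} → g ∣P f → ¬ (coeff f 0 ≈ + 0) → ¬ (coeff g 0 ≈ + 0)
  ∣P-coeff₀≉0 {g} {f} (w ∣, e) nz g0 = nz
      (≈-trans (≈-sym (at≋ e 0))
        (≈-trans (≈-reflexive (coeff₀-⊗ g w))
          (≈-trans (*-cong g0 (≈-refl {coeff w 0})) (≈-reflexive (ZP.*-zeroˡ (coeff w 0))))))

  ∣P⇒annihilates-y :
      ∀ s e (len : length s ≡ suc e) h → monicPoly s ∣P h → ∀ n → act h (Window.y s e len) n ≈ + 0
  ∣P⇒annihilates-y s e len h (w ∣, eq) n = ≈-trans (act-≋ y n (≋-sym eq))
      (≈-trans (act-≋ y n (≐⇒≋ (⊗-comm≐ (monicPoly s) w)))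
        (≈-trans (≈-reflexive (act-⊗ w (monicPoly s) y n))
          (≈-trans (act-congʳ w n (λ k _ → ≈-reflexive (Window.monicPoly-annihilates-y s e len k)))
            (act-0 w n))))
    where
      y : Seq
      y = Window.y s e len

  one-^ : ∀ n → one ^P n ≋ one
  one-^ zero = ≋-refl
  one-^ (suc n) = ≋-trans (⊗-cong≋ (≋-refl {one}) (one-^ n)) (≐⇒≋ (⊗-idˡ≐ one))

  Xpow-^ : ∀ q n → Xpow q ^P n ≋ Xpow (n ℕ.* q)
  Xpow-^ q zero = ≋-refl
  Xpow-^ q (suc n) = ≋-trans (⊗-cong≋ (≋-refl {Xpow q}) (Xpow-^ q n)) (≐⇒≋ (Xpow-+≐ q (n ℕ.* q)))

  []-^ : ∀ n → 1 ≤ n → [] ^P n ≋ []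
  []-^ (suc n) _ = ≋-refl

  neg-one-^p : neg one ^P p ≋ neg one
  neg-one-^p = ≋-trans (≐⇒≋ (≐-sym (l (neg one ^P p))))
      (≋-trans
        (⊕-cong≋
          (≋-trans (≋-sym (⊕-cong≋ (one-^ p) ≋-refl))
            (≋-trans (≋-sym (frobenius one (neg one)))
              (≋-trans (E.^-congˡ p (≐⇒≋ (⊕-invʳ≐ one))) ([]-^ p (ℕP.≤-trans (ℕP.n≤1+n 1) p≥2)))))
          (≋-refl {neg one})) ≋-refl)
    where l : ∀ B → (one ⊕ B) ⊕ neg one ≐ B
          l B = mk≐ λ i → trans (coeff-⊕ (one ⊕ B) (neg one) i)
              (trans (cong₂ _+_ (coeff-⊕ one B i) (coeff-neg one i)) (lz (coeff one i) (coeff B i)))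
            where lz : ∀ a b → a + b + - a ≡ b
                  lz = solve-∀

  -tk≉0 : ∀ tk → ¬ ((+ p) ∣ℤ tk) → ¬ (- tk ≈ + 0)
  -tk≉0 tk nd e = nd
      (∣⇒∣ᵤ {+ p} {tk} (Vanishes-resp (ZP.neg-involutive tk) (Vanishes-neg (≈0⇒Vanishes { - tk} e))))

  irreducible-∣-^ :
      ∀ sg → MonicIrreducible p sg → ∀ F n → monicPoly sg ∣P F ^P n → ¬ ¬ (monicPoly sg ∣P F)
  irreducible-∣-^ sg irr F zero d = λ _ → monic∤constant (monicPoly-monic sg) (proj₁ irr) (+ 1) 1≉0
      d
  irreducible-∣-^ sg irr F (suc n) d = irreducible-prime sg irr F (F ^P n) d >>= λ
      { (inj₁ x) → pure x ; (inj₂ y) → irreducible-∣-^ sg irr F n y }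

  Xpow-1-^p : ∀ q → Xpow-1 q ^P p ≋ Xpow-1 (q ℕ.* p)
  Xpow-1-^p q = ≋-trans (frobenius (Xpow q) (neg one))
      (⊕-cong≋ (≋-trans (Xpow-^ q p) (≡⇒≋ (cong Xpow (ℕP.*-comm p q)))) neg-one-^p)

  quotient-positive : ∀ q π → π ≡ q ℕ.* p → 1 ≤ π → 1 ≤ q
  quotient-positive zero π eq h = ⊥-elim (ℕP.<⇒≱ h (ℕP.≤-reflexive eq))
  quotient-positive (suc _) π eq h = s≤s z≤n

  module Bridge (s : List ℤ) (e : ℕ) (len : length s ≡ suc e) where
    open Window s e len

    m : Poly
    m = monicPoly s

    m-monic : MonicOfDegree m (suc e)
    m-monic = subst (MonicOfDegree m) len (monicPoly-monic s)

    monicPoly-annihilates-y≈ : ∀ n → act m y n ≈ + 0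
    monicPoly-annihilates-y≈ n = ≈-reflexive (monicPoly-annihilates-y n)

    -- The values of y just before and at n = e are 0, …, 0, 1, so a polynomial of degree ≤ e
    -- annihilating y has all its coefficients zero, from the top down.
    annihilator-DegBelow⇒≋[] : ∀ r j → j ≤ suc e → DegBelow r j → (∀ n → act r y n ≈ + 0) → r ≋ []
    annihilator-DegBelow⇒≋[] r zero le b h = DegBelow-0 b
    annihilator-DegBelow⇒≋[] r (suc j) le b h = annihilator-DegBelow⇒≋[] r j
        (ℕP.≤-trans (ℕP.n≤1+n j) le) (mkDegBelow bnd) h
      where
        n0 : ℕ
        n0 = e ∸ j
        je : j ≤ e
        je = ℕP.≤-pred le
        hyp : ∀ i → i < j → y (n0 ℕ.+ i) ≡ + 0
        hyp i lt = y-initial (n0 ℕ.+ i) (subst (n0 ℕ.+ i <_) (ℕP.m∸n+n≡m je) (ℕP.+-monoʳ-< n0 lt))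
        cj : coeff r j ≈ + 0
        cj = ≈-trans
            (≈-reflexive
              (sym
                (trans (cong (coeff r j *_) (trans (cong y (ℕP.m∸n+n≡m je)) y-e≡1))
                  (ZP.*-identityʳ _)))) (≈-trans (≈-sym (act-lowestTerm y r n0 j b hyp)) (h n0))
        bnd : ∀ i → j ≤ i → coeff r i ≈ + 0
        bnd i le' with ℕP.m≤n⇒m<n∨m≡n le'
        ... | inj₁ lt = vanishes b i lt
        ... | inj₂ refl = cj

    y-period⇒annihilated : ∀ c → (∀ i → y (i ℕ.+ c) ≈ y i) → ∀ n → act (Xpow-1 c) y n ≈ + 0
    y-period⇒annihilated c h n = ≈-trans (≈-reflexive (act-Xpow-1 c y n)) (≈⇒−≈0 (h n))

    y-period⇒∣Xpow-1 : ∀ c → (∀ i → y (i ℕ.+ c) ≈ y i) → m ∣P Xpow-1 c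
    y-period⇒∣Xpow-1 c h with divide m-monic (length (Xpow-1 c)) (Xpow-1 c)
        (DegBelow-length (Xpow-1 c))
    ... | q , r , br , eq = q ∣, ≋-trans (≐⇒≋ (≐-sym (⊕-idʳ≐ (m ⊗ q))))
        (≋-trans (⊕-cong≋ (≋-refl {m ⊗ q}) (≋-sym r0)) (≋-sym eq))
      where
        mq0 : ∀ n → act (m ⊗ q) y n ≈ + 0
        mq0 n = ≈-trans (act-≋ y n (≐⇒≋ (⊗-comm≐ m q)))
            (≈-trans (≈-reflexive (act-⊗ q m y n))
              (≈-trans (act-congʳ q n (λ k _ → monicPoly-annihilates-y≈ k)) (act-0 q n)))
        r0 : r ≋ []
        r0 = annihilator-DegBelow⇒≋[] r (suc e) ℕP.≤-refl br λ n → +-cancelʳ-≈ {act r y n} {+ 0}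
            {act (m ⊗ q) y n}
            (≈-trans (≈-reflexive (trans (ZP.+-comm (act r y n) _) (sym (act-⊕ (m ⊗ q) r y n))))
              (≈-trans (≈-sym (act-≋ y n eq))
                (≈-trans (y-period⇒annihilated c h n)
                  (≈-trans (≈-sym (mq0 n)) (≈-reflexive (sym (ZP.+-identityˡ _)))))))

    ∣Xpow-1⇒y-period : ∀ c → m ∣P Xpow-1 c → ∀ i → y (i ℕ.+ c) ≈ y i
    ∣Xpow-1⇒y-period c (q ∣, eq) i = −≈0⇒≈
        (≈-trans (≈-reflexive (sym (act-Xpow-1 c y i))) (≈-trans (act-≋ y i (≋-sym eq)) mq0))
      where
        mq0 : act (m ⊗ q) y i ≈ + 0
        mq0 = ≈-trans (act-≋ y i (≐⇒≋ (⊗-comm≐ m q)))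
            (≈-trans (≈-reflexive (act-⊗ q m y i))
              (≈-trans (act-congʳ q i (λ k _ → monicPoly-annihilates-y≈ k)) (act-0 q i)))

    y-period⇒lrs-period : ∀ c → (∀ i → y (i ℕ.+ c) ≈ y i) → IsPeriod p (lrs s) c
    y-period⇒lrs-period c h n = un≈
        (≈-trans (≈-reflexive (trans (lrs≡y (n ℕ.+ c)) (cong y (l n c e))))
          (≈-trans (h (n ℕ.+ e)) (≈-reflexive (sym (lrs≡y n)))))
      where l : ∀ n c e → n ℕ.+ c ℕ.+ e ≡ n ℕ.+ e ℕ.+ c
            l n c e = trans (ℕP.+-assoc n c e)
                (trans (cong (n ℕ.+_) (ℕP.+-comm c e)) (sym (ℕP.+-assoc n e c)))

    lrs-period⇒y-period-late : ∀ c → IsPeriod p (lrs s) c → ∀ i → e ≤ i → y (i ℕ.+ c) ≈ y i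
    lrs-period⇒y-period-late c h i le = ≈-trans
        (≈-reflexive (cong y (trans (cong (ℕ._+ c) (sym k≡)) (l (i ∸ e) c e))))
        (≈-trans (≈-reflexive (sym (lrs≡y (i ∸ e ℕ.+ c))))
          (≈-trans (mk≈ (h (i ∸ e))) (≈-reflexive (trans (lrs≡y (i ∸ e)) (cong y k≡)))))
      where k≡ : i ∸ e ℕ.+ e ≡ i
            k≡ = ℕP.m∸n+n≡m le
            l : ∀ n c e → n ℕ.+ e ℕ.+ c ≡ n ℕ.+ c ℕ.+ e
            l n c e = trans (ℕP.+-assoc n e c)
                (trans (cong (n ℕ.+_) (ℕP.+-comm e c)) (sym (ℕP.+-assoc n c e)))

    y-period-step-back :
        ∀ f → (∀ n → act f y n ≈ + 0) → ¬ (coeff f 0 ≈ + 0) → ∀ c m' → (∀ i → m' < i → y (i ℕ.+ c) ≈ y i)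
        → y (m' ℕ.+ c) ≈ y m'
    y-period-step-back [] h nz c m' hi = ⊥-elim (nz ≈-refl)
    y-period-step-back (a ∷ f) h nz c m' hi = *-cancelˡ-≈ nz
        (+-cancelʳ-≈ {a * y (m' ℕ.+ c)} {a * y m'} {act f y (suc m')}
          (≈-trans
            (+-cong (≈-refl {a * y (m' ℕ.+ c)}) (≈-sym (act-congʳ f (suc m') λ k le → hi k le)))
            (≈-trans (≈-reflexive (sym (act-shift (a ∷ f) y m' c)))
              (≈-trans (h (m' ℕ.+ c)) (≈-sym (h m'))))))

    -- Periodicity propagates back into the initial zeros because m(0) is invertible.
    lrs-period⇒y-period-from :
        ∀ c → ¬ (coeff m 0 ≈ + 0) → IsPeriod p (lrs s) c → ∀ t i → e ≤ i ℕ.+ t → y (i ℕ.+ c) ≈ y i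
    lrs-period⇒y-period-from c nz per zero i le = lrs-period⇒y-period-late c per i
        (subst (e ≤_) (ℕP.+-identityʳ i) le)
    lrs-period⇒y-period-from c nz per (suc t) i le =
        y-period-step-back m monicPoly-annihilates-y≈ nz c i λ j lt → lrs-period⇒y-period-from c nz
          per t j (ℕP.≤-trans le (subst (_≤ j ℕ.+ t) (sym (ℕP.+-suc i t)) (ℕP.+-monoˡ-≤ t lt)))

    lrs-period⇒∣Xpow-1 : ∀ c → ¬ (coeff m 0 ≈ + 0) → IsPeriod p (lrs s) c → m ∣P Xpow-1 c
    lrs-period⇒∣Xpow-1 c nz per = y-period⇒∣Xpow-1 c λ i → lrs-period⇒y-period-from c nz per e i
        (ℕP.m≤n+m e i)

    ∣Xpow-1⇒lrs-period : ∀ c → m ∣P Xpow-1 c → IsPeriod p (lrs s) c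
    ∣Xpow-1⇒lrs-period c d = y-period⇒lrs-period c (∣Xpow-1⇒y-period c d)

  period⇒∣Xpow-1 :
      ∀ s {c} → 1 ≤ length s → ¬ (coeff (monicPoly s) 0 ≈ + 0) → IsPeriod p (lrs s) c → monicPoly s ∣P Xpow-1 c
  period⇒∣Xpow-1 (x ∷ s) {c} _ = Bridge.lrs-period⇒∣Xpow-1 (x ∷ s) (length s) refl c

  ∣Xpow-1⇒period : ∀ s {c} → 1 ≤ length s → monicPoly s ∣P Xpow-1 c → IsPeriod p (lrs s) c
  ∣Xpow-1⇒period (x ∷ s) {c} _ = Bridge.∣Xpow-1⇒lrs-period (x ∷ s) (length s) refl c

  IsPeriod-stable : ∀ x {c} → ¬ ¬ IsPeriod p x c → IsPeriod p x c
  IsPeriod-stable x {c} ¬¬per n = un≈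
      (≈-stable {x (n ℕ.+ c)} {x n} λ ≉ → ¬¬per λ per → ≉ (mk≈ (per n)))

  IsPeriod-∣ : ∀ {x π L} → IsPeriod p x π → π ∣ L → IsPeriod p x L
  IsPeriod-∣ {x} {π} per (ND.divides k refl) = IsPeriod-* x π per k

  Any-period⇒lcmList-period : ∀ {x πs} → Any (IsPeriod p x) πs → IsPeriod p x (lcmList πs)
  Any-period⇒lcmList-period {x} (here per) = IsPeriod-∣ {x} per (m∣lcm[m,n] _ _)
  Any-period⇒lcmList-period {x} {π ∷ _} (there per) =
      IsPeriod-∣ {x} (Any-period⇒lcmList-period {x} per) (n∣lcm[m,n] π _)

  p∤leastPeriod :
      ∀ {g π} → MonicIrreducible p g → ¬ (coeff (monicPoly g) 0 ≈ + 0) → IsLeastPeriod p (lrs g) π → ¬ (p ∣ π)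
  p∤leastPeriod {g} {π} g-irr g₀≉0 (π≥1 , π-period , π-least) (ND.divides q π≡qp) =
    irreducible-∣-^ g g-irr (Xpow-1 q) p g∣[X^q−1]^p g∤X^q−1
    where
      g∣[X^q−1]^p : monicPoly g ∣P Xpow-1 q ^P p
      g∣[X^q−1]^p = ∣P-resp ≋-refl (≋-sym (≋-trans (Xpow-1-^p q) (≡⇒≋ (cong Xpow-1 (sym π≡qp)))))
          (period⇒∣Xpow-1 g (proj₁ g-irr) g₀≉0 π-period)
      q≥1 : 1 ≤ q
      q≥1 = quotient-positive q π π≡qp π≥1
      g∤X^q−1 : ¬ (monicPoly g ∣P Xpow-1 q)
      g∤X^q−1 g∣ = ℕP.<⇒≱ (subst (q <_) (sym π≡qp) (ℕP.m<m*n q p {{ℕ.>-nonZero q≥1}} p≥2))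
          (π-least q q≥1 (∣Xpow-1⇒period g (proj₁ g-irr) g∣))

  -- geomSum L q acts on an L-periodic sequence as multiplication by q.
  ∣Xpow-1∧∣geomSum⇒p∣q :
      ∀ {g L q} → 1 ≤ length g → monicPoly g ∣P Xpow-1 L → monicPoly g ∣P geomSum L q → p ∣ q
  ∣Xpow-1∧∣geomSum⇒p∣q {x ∷ g} {L} {q} _ g∣X^L−1 g∣Φ = SD.∣⇒∣ᵤ {+ p} {+ q} (≈0⇒Vanishes {+ q} q≈0)
    where
      open Window (x ∷ g) (length g) refl using (y; y-e≡1)
      y-periodic : ∀ i → y (i ℕ.+ L) ≈ y i
      y-periodic = Bridge.∣Xpow-1⇒y-period (x ∷ g) (length g) refl L g∣X^L−1
      q≈0 : + q ≈ + 0
      q≈0 = ≈-trans (≈-reflexive (sym (trans (cong (+ q *_) y-e≡1) (ZP.*-identityʳ (+ q)))))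
              (≈-trans (≈-sym (shiftSum-periodic y L y-periodic q (length g)))
                (≈-trans (≈-reflexive (sym (act-geomSum L q y (length g))))
                  (∣P⇒annihilates-y (x ∷ g) (length g) refl (geomSum L q) g∣Φ (length g))))

  module _ (s : List ℤ) {gs : List (List ℤ)} {πs : List ℕ}
           (s₀≉0 : ¬ (coeff (monicPoly s) 0 ≈ + 0))
           (factors : All (λ g → MonicIrreducible p g × MonicDivides p g s) gs)
           (periods : Pointwise (λ g π → IsLeastPeriod p (lrs g) π) gs πs) where

    lcmList-∣-period : ∀ {c} → 1 ≤ length s → IsPeriod p (lrs s) c → lcmList πs ∣ c
    lcmList-∣-period {c} s≢[] c-period = go factors periods
      where
        go : ∀ {gs πs} → All (λ g → MonicIrreducible p g × MonicDivides p g s) gs →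
             Pointwise (λ g π → IsLeastPeriod p (lrs g) π) gs πs → lcmList πs ∣ c
        go [] [] = ND.1∣ c
        go {g ∷ _} {π ∷ _} ((g-irr , g∣s) ∷ factors) (π-least ∷ periods) =
          lcm-least (leastPeriod-∣-period (lrs g) π c π-least (∣Xpow-1⇒period g (proj₁ g-irr) g∣X^c−1))
                    (go factors periods)
          where
            g∣X^c−1 : monicPoly g ∣P Xpow-1 c
            g∣X^c−1 = ∣P-trans (MonicDivides⇒∣P {g} {s} g∣s) (period⇒∣Xpow-1 s s≢[] s₀≉0 c-period)

    p∤lcmList : ¬ (p ∣ lcmList πs)
    p∤lcmList = go factors periods
      where
        go : ∀ {gs πs} → All (λ g → MonicIrreducible p g × MonicDivides p g s) gs →
             Pointwise (λ g π → IsLeastPeriod p (lrs g) π) gs πs → ¬ (p ∣ lcmList πs)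
        go [] [] p∣1 = ℕP.<⇒≱ p≥2 (ND.∣⇒≤ p∣1)
        go {g ∷ _} {π ∷ πs} ((g-irr , g∣s) ∷ factors) (π-least ∷ periods) p∣L
          with euclidsLemma π (lcmList πs) pp (ND.∣-trans p∣L (lcm∣* π (lcmList πs)))
        ... | inj₁ p∣π = p∤leastPeriod g-irr (∣P-coeff₀≉0 (MonicDivides⇒∣P {g} {s} g∣s) s₀≉0)
            π-least p∣π
        ... | inj₂ p∣L′ = go factors periods p∣L′

    module _ (complete : ∀ g → MonicIrreducible p g → MonicDivides p g s →
                         Any (λ h → PolyEq p (monicPoly g) (monicPoly h)) gs) where

      irreducibleFactor-∣Xpow-lcm-1 :
          ∀ {g} → MonicIrreducible p g → monicPoly g ∣P monicPoly s → monicPoly g ∣P Xpow-1 (lcmList πs)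
      irreducibleFactor-∣Xpow-lcm-1 {g} g-irr g∣s =
        period⇒∣Xpow-1 g (proj₁ g-irr) (∣P-coeff₀≉0 g∣s s₀≉0)
          (Any-period⇒lcmList-period {lrs g}
            (Any-zip transfer (complete g g-irr (∣P⇒MonicDivides {g} {s} g∣s)) factors periods))
        where
          transfer : ∀ {h π} → PolyEq p (monicPoly g) (monicPoly h) →
                     MonicIrreducible p h × MonicDivides p h s → IsLeastPeriod p (lrs h) π → IsPeriod p (lrs g) π
          transfer {h} g≡h (h-irr , h∣s) (_ , h-period , _) =
            ∣Xpow-1⇒period g (proj₁ g-irr) (∣P-resp (≋-sym (PolyEq⇒≋ g≡h)) ≋-refl
              (period⇒∣Xpow-1 h (proj₁ h-irr) (∣P-coeff₀≉0 (MonicDivides⇒∣P {h} {s} h∣s) s₀≉0)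
                  h-period) )

      lcmList-period :
          ∀ {c} → 1 ≤ length s → IsPeriod p (lrs s) c → ¬ (p ∣ c) → lcmList πs ∣ c → IsPeriod p (lrs s) (lcmList πs)
      lcmList-period {c} s≢[] c-period p∤c (ND.divides q c≡qL) =
        IsPeriod-stable (lrs s) do
          s∣X^L−1 ← ∣P-cancel-coprime (length s) ℕP.≤-refl (monicPoly-monic s) s∣AΦ no-common-factor
          pure (∣Xpow-1⇒period s s≢[] s∣X^L−1)
        where
          L : ℕ
          L = lcmList πs
          s∣AΦ : monicPoly s ∣P Xpow-1 L ⊗ geomSum L q
          s∣AΦ = ∣P-resp ≋-refl
            (≐⇒≋
                (≐-sym
                  (subst (λ k → Xpow-1 L ⊗ geomSum L q ≐ Xpow-1 k) (sym c≡qL)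
                    (Xpow-1-⊗-geomSum≐ L q))))
            (period⇒∣Xpow-1 s s≢[] s₀≉0 c-period)
          no-common-factor : NoCommonIrreducibleFactor (monicPoly s) (geomSum L q)
          no-common-factor g g-irr g∣s g∣Φ =
            p∤c (subst (p ∣_) (sym c≡qL) (ND.∣-trans p∣q (ND.m∣m*n L)))
            where
              p∣q : p ∣ q
              p∣q = ∣Xpow-1∧∣geomSum⇒p∣q {g} {L} {q} (proj₁ g-irr)
                  (irreducibleFactor-∣Xpow-lcm-1 {g} g-irr g∣s) g∣Φ

proposition5p1 : (rs : List ℤ) (tk : ℤ) (p : ℕ) → Prime p → ¬ ((+ p) ∣ℤ tk) →
    ¬ MonicIrreducible p (rs ∷ʳ tk) →
    (gs : List (List ℤ)) →
    All (λ g → MonicIrreducible p g × MonicDivides p g (rs ∷ʳ tk)) gs →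
    AllPairs (λ g h → ¬ PolyEq p (monicPoly g) (monicPoly h)) gs →
    (∀ g → MonicIrreducible p g → MonicDivides p g (rs ∷ʳ tk) →
       Any (λ h → PolyEq p (monicPoly g) (monicPoly h)) gs) →
    (πs : List ℕ) → Pointwise (λ g π → IsLeastPeriod p (lrs g) π) gs πs →
    (c : ℕ) → IsLeastPeriod p (F (rs ∷ʳ tk)) c →
    (¬ (p ∣ c) → c ≡ lcmList πs) × (p ∣ c → lcmList πs ∣ c × c ≢ lcmList πs)
proposition5p1 rs tk p pp p∤tk _ gs factors _ complete πs periods c (c≥1 , c-period , c-least) =
    (λ p∤c → ℕP.≤-antisym (c-least L L≥1 (L-period p∤c)) L≤c)
  , (λ p∣c → L∣c , λ c≡L → p∤lcmList s s₀≉0 factors periods (subst (p ∣_) c≡L p∣c))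
  where
    open Modulo p pp
    s : List ℤ
    s = rs ∷ʳ tk
    L : ℕ
    L = lcmList πs
    s≢[] : 1 ≤ length s
    s≢[] = subst (1 ≤_) (sym (length-∷ʳ rs tk)) (s≤s z≤n)
    s₀≉0 : ¬ (coeff (monicPoly s) 0 ≈ + 0)
    s₀≉0 s₀≈0 = -tk≉0 tk p∤tk (≈-trans (≈-reflexive (sym (coeff₀-monicPoly-∷ʳ rs tk))) s₀≈0)
    L∣c : L ∣ c
    L∣c = lcmList-∣-period s s₀≉0 factors periods s≢[] c-period
    L≤c : L ≤ c
    L≤c = ND.∣⇒≤ {{ℕ.>-nonZero c≥1}} L∣c
    L-period : ¬ (p ∣ c) → IsPeriod p (F s) L
    L-period p∤c = lcmList-period s s₀≉0 factors periods complete s≢[] c-period p∤c L∣c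
    L≥1 : 1 ≤ L
    L≥1 = ℕP.n≢0⇒n>0 λ L≡0 → ℕP.<⇒≢ c≥1 (sym (ND.0∣⇒≡0 (subst (_∣ c) L≡0 L∣c)))
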